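{- Let $d\ge2$, $\boldsymbol\gamma_0=(1^2,2^2,\dots,d^2)\in\mathbb R^d$, $\mathbf a_i=-\mathbf e_i+\mathbf e_{i+1}$, and $P=\operatorname{Conv}\{\boldsymbol\gamma_0+\mathbf a_i:1\le i\le d-1\}$. Then the polytope $\mathfrak S_d(P)=\operatorname{Conv}\{(x_{\pi(1)},\dots,x_{\pi(d)}):\ \mathbf x\in P,\ \pi\in\mathfrak S_d\}$ has face poset (nonempty faces ordered by inclusion) isomorphic to the poset $\mathcal F_d$ of decorated ordered set partitions of $[d]$.
   Context: An ordered set partition $\mathcal S=(S_1,\dots,S_k)$ of $[d]$ is an ordered list of pairwise disjoint nonempty blocks with union $[d]$; $\operatorname{Type}(\mathcal S)=\{\sum_{j\le i}|S_j|:1\le i\le k-1\}\subseteq[d-1]$. $\mathcal O_d$ is the set of ordered set partitions ordered by $\mathcal S\le\mathcal S'$ iff $\mathcal S$ refines $\mathcal S'$ (i.e. $\mathcal S'$ is obtained by merging consecutive blocks of $\mathcal S$). A decorated ordered set partition of $[d]$ is a pair $(\mathcal S,B)$ where $\mathcal S\in\mathcal O_d$ has $k$ blocks and either $k>1$ and $B$ is a nonempty subset of $\operatorname{Type}(\mathcal S)$, or $k=1$ (i.e. $\mathcal S=([d])$) and $B=[d-1]$. $\mathcal F_d$ is the poset of decorated ordered set partitions of $[d]$ with $(\mathcal S,B)\preceq(\mathcal S',B')$ iff $\mathcal S\le\mathcal S'$ in $\mathcal O_d$ and $B\subseteq B'$.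
   Formalization: The polytope $\mathfrak S_d(P)$ and its faces are taken in ℚ^d, with rational convex combinations and rational supporting functionals, rather than in ℝ^d. -}

module Defs where

open import Data.Nat as ℕ using (ℕ; zero; suc; _^_)
open import Data.Nat.Properties as ℕP using ()
open import Data.Integer using (+_)
open import Data.Rational using (ℚ; 0ℚ; 1ℚ; _+_; _*_; -_; _≤_; _/_)
open import Data.Fin using (Fin; toℕ)
open import Data.Fin.Permutation using (Permutation′; _⟨$⟩ʳ_)
open import Data.Fin.Properties as FinP using ()
open import Data.List using (List; []; _∷_; length; filter; allFin; map; foldr)
open import Data.Nat.ListAction using (sum)
open import Data.List.Relation.Unary.All using (All)
open import Data.List.Membership.Propositional using (_∈_)
open import Data.Product using (Σ; ∃; ∃-syntax; _×_; _,_; proj₁; proj₂)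
open import Data.Sum using (_⊎_)
open import Data.Bool using (if_then_else_)
open import Relation.Binary.PropositionalEquality using (_≡_)
open import Relation.Nullary.Decidable using (⌊_⌋)

-- Points of ℚ^d (coordinates 0-indexed: coordinate k stands for k+1)

Pt : ℕ → Set
Pt d = Fin d → ℚ

ℕ→ℚ : ℕ → ℚ
ℕ→ℚ n = + n / 1

_·_ : {d : ℕ} → Pt d → Pt d → ℚ
_·_ {d} c x = foldr (λ k s → c k * x k + s) 0ℚ (allFin d)

-- unit vector e_{i+1} (i is 0-indexed)
e : (d : ℕ) → ℕ → Pt d
e d i k = if ⌊ toℕ k ℕ.≟ i ⌋ then 1ℚ else 0ℚ

γ₀ : (d : ℕ) → Pt d
γ₀ d k = ℕ→ℚ (suc (toℕ k) ^ 2)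

-- a_{i+1} = - e_{i+1} + e_{i+2}   (i 0-indexed, 0 ≤ i ≤ d-2)
a : (d : ℕ) → ℕ → Pt d
a d i k = - e d i k + e d (suc i) k

Gen : (d : ℕ) → Pt d → Set
Gen d y = Σ ℕ λ i → (suc i ℕ.< d) × (∀ k → y k ≡ γ₀ d k + a d i k)

Conv : {d : ℕ} → (Pt d → Set) → Pt d → Set
Conv {d} S y =
  Σ (List (ℚ × Pt d)) λ L →
    All (λ p → (0ℚ ≤ proj₁ p) × S (proj₂ p)) L
    × (foldr (λ p s → proj₁ p + s) 0ℚ L ≡ 1ℚ)
    × (∀ k → y k ≡ foldr (λ p s → proj₁ p * proj₂ p k + s) 0ℚ L)

P : (d : ℕ) → Pt d → Set
P d = Conv (Gen d)

SdP : (d : ℕ) → Pt d → Set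
SdP d = Conv (λ y → Σ (Pt d) λ x → P d x × Σ (Permutation′ d) λ π → ∀ k → y k ≡ x (π ⟨$⟩ʳ k))

-- Nonempty faces of a subset Q ⊆ ℚ^d: Q ∩ {c·x = M} where Q ⊆ {c·x ≤ M}
-- (c = 0, M = 0 gives Q itself), required to be nonempty.

record Face {d : ℕ} (Q : Pt d → Set) : Set where
  field
    c        : Pt d
    M        : ℚ
    support  : ∀ x → Q x → c · x ≤ M
    nonempty : Σ (Pt d) λ x → Q x × (c · x ≡ M)

faceSet : {d : ℕ} {Q : Pt d → Set} → Face Q → Pt d → Set
faceSet {Q = Q} F x = Q x × (Face.c F · x ≡ Face.M F)

_⊆F_ : {d : ℕ} {Q : Pt d → Set} → Face Q → Face Q → Set
_⊆F_ {d} F G = ∀ (x : Pt d) → faceSet F x → faceSet G x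

-- Ordered set partitions of [d]: k blocks, element x ∈ Fin d lies in
-- block (blk x) ∈ Fin k; every block nonempty.

record OSP (d : ℕ) : Set where
  field
    k    : ℕ
    blk  : Fin d → Fin k
    surj : ∀ (j : Fin k) → Σ (Fin d) λ x → blk x ≡ j

blockSize : {d : ℕ} (S : OSP d) → Fin (OSP.k S) → ℕ
blockSize {d} S j = length (filter (λ x → OSP.blk S x FinP.≟ j) (allFin d))

partialSum : {d : ℕ} (S : OSP d) → Fin (OSP.k S) → ℕ
partialSum S i =
  sum (map (blockSize S) (filter (λ j → toℕ j ℕ.≤? toℕ i) (allFin (OSP.k S))))

-- n ∈ Type(S) = { Σ_{j ≤ i} |S_j| : 1 ≤ i ≤ k-1 }
InType : {d : ℕ} → OSP d → ℕ → Set
InType S n = Σ (Fin (OSP.k S)) λ i → (suc (toℕ i) ℕ.< OSP.k S) × (n ≡ partialSum S i)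

-- refinement: S ≤ S' iff S' is obtained by merging consecutive blocks of S,
-- i.e. blk' = m ∘ blk for a weakly increasing surjection m of block indices
_≤O_ : {d : ℕ} → OSP d → OSP d → Set
S ≤O S' =
  Σ (Fin (OSP.k S) → Fin (OSP.k S')) λ m →
    (∀ i j → toℕ i ℕ.≤ toℕ j → toℕ (m i) ℕ.≤ toℕ (m j))
    × (∀ j' → Σ (Fin (OSP.k S)) λ j → m j ≡ j')
    × (∀ x → OSP.blk S' x ≡ m (OSP.blk S x))

-- Decorated ordered set partitions (B given as a list of naturals,
-- understood as the set of its members)

record DOSP (d : ℕ) : Set where
  field
    S  : OSP d
    B  : List ℕ
    ok : ((1 ℕ.< OSP.k S) × (∀ n → n ∈ B → InType S n) × (Σ ℕ λ n → n ∈ B))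
         ⊎
         ((OSP.k S ≡ 1) × (∀ n → (n ∈ B → (1 ℕ.≤ n × n ℕ.≤ d ℕ.∸ 1))
                                × ((1 ℕ.≤ n × n ℕ.≤ d ℕ.∸ 1) → n ∈ B)))

_≼_ : {d : ℕ} → DOSP d → DOSP d → Set
D ≼ D' = (DOSP.S D ≤O DOSP.S D') × (∀ n → n ∈ DOSP.B D → n ∈ DOSP.B D')

-- Isomorphism of (pre)posets, elements identified up to mutual ≤

record OrderIso {A B : Set} (_≤A_ : A → A → Set) (_≤B_ : B → B → Set) : Set where
  field
    to      : A → B
    from    : B → A
    to-mono : ∀ x y → x ≤A y → to x ≤B to y
    to-refl : ∀ x y → to x ≤B to y → x ≤A y
    to-from : ∀ b → (to (from b) ≤B b) × (b ≤B to (from b))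
    from-to : ∀ x → (from (to x) ≤A x) × (x ≤A from (to x))

-- A nonempty face of 𝔖_d(P) is cut out by a linear functional c, and its vertices
-- σ·(γ₀ + a_{i+1}) are the maximisers of c over the vertex set. Since γ₀ + a_{i+1} is strictly
-- increasing, the rearrangement inequality says that the value is largest when σ sorts c, and
-- then it equals a quantity depending only on the sorted values s of c plus the gap
-- s_{i+1} − s_i. So the face is described by the level sets of c in increasing order (an
-- ordered set partition) and by the positions of the maximal gap: these are cut positions of
-- the partition when c is not constant, and all of [d−1] when it is. Conversely (S, B) is the
-- face of the functional that is constant on the blocks of S and rises by 2 across the cuts in
-- B and by 1 across the other cuts. Inclusion of faces is inclusion of their sets of optimal
-- vertices, which translates into refinement of the partitions and inclusion of the decorations.

module Submission where

open import Defs
open import Algebra.Bundles using (CommutativeMonoid; CommutativeRing; Semiring)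
import Algebra.Properties.CommutativeMonoid.Sum as CommutativeMonoidSum
import Algebra.Properties.Group as GroupProperties
import Algebra.Properties.Semiring.Sum as SemiringSum
open import Data.Empty using (⊥-elim)
open import Data.Fin.Base as Fin using (Fin; zero; suc; toℕ; fromℕ<; inject₁; punchIn; punchOut)
open import Data.Fin.Permutation as Perm
  using (Permutation′; _⟨$⟩ʳ_; _⟨$⟩ˡ_; inverseˡ; inverseʳ; flip; insert; remove; transpose; _∘ₚ_)
import Data.Fin.Permutation.Components as PC
import Data.Fin.Properties as FinP
import Data.Integer.Base as ℤ
import Data.Integer.Properties as ℤP
open import Data.List.Base using (List; []; _∷_; foldr; map; filter; tabulate; allFin; length)
open import Data.List.Membership.Propositional using (_∈_)
import Data.List.Membership.Propositional.Properties as Membership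
open import Data.List.Relation.Unary.All as All using (All; []; _∷_)
open import Data.Nat.Base as ℕ using (ℕ; zero; suc; z≤n; s≤s; _≤_)
import Data.Nat.Coprimality as Coprimality
import Data.Nat.ListAction as List
import Data.Nat.Properties as ℕP
import Data.Nat.Solver as ℕ-Solver
open import Data.List.Membership.DecPropositional ℕP._≟_ using (_∈?_)
open import Data.Product.Base using (Σ; ∃; _×_; _,_; proj₁; proj₂)
open import Data.Rational.Base as ℚ using (ℚ; 0ℚ; 1ℚ; _+_; _*_; -_; _-_; mkℚ; _/_)
import Data.Rational.Properties as ℚP
open import Data.Rational.Solver using () renaming (module +-*-Solver to ℚ-Solver)
open import Data.Sum.Base using (_⊎_; inj₁; inj₂)
open import Function.Base using (_∘_)
open import Level using (0ℓ)
open import Relation.Binary.Core using (_Preserves_⟶_)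
open import Relation.Binary.Definitions using (tri<; tri≈; tri>)
open import Relation.Binary.PropositionalEquality hiding (setoid)
open import Relation.Nullary using (Dec; yes; no; ¬_)
open import Relation.Nullary.Decidable using (dec-true; dec-false; toWitness)
open import Relation.Unary using (Pred; Decidable)

open GroupProperties ℚP.+-0-group using (∙-cancelˡ)

module SumSupport {c ℓ} (M : CommutativeMonoid c ℓ) where
  open CommutativeMonoid M using (setoid; _≈_; ∙-congˡ; identityʳ) renaming (Carrier to A; _∙_ to _+ᴹ_; ε to 0ᴹ)
  open CommutativeMonoidSum M using (sum; sum-cong-≋; sum-remove; sum-replicate-zero)
  open import Relation.Binary.Reasoning.Setoid setoid

  sum-supported-at : ∀ {n} (f : Fin n → A) x → (∀ k → k ≢ x → f k ≈ 0ᴹ) → sum f ≈ f x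
  sum-supported-at {suc n} f x zero-off-x = begin
    sum f                          ≈⟨ sum-remove f ⟩
    f x +ᴹ sum (f ∘ punchIn x)     ≈⟨ ∙-congˡ (sum-cong-≋ (λ k → zero-off-x _ (FinP.punchInᵢ≢i x k))) ⟩
    f x +ᴹ sum {n} (λ _ → 0ᴹ)      ≈⟨ ∙-congˡ (sum-replicate-zero n) ⟩
    f x +ᴹ 0ᴹ                      ≈⟨ identityʳ (f x) ⟩
    f x                            ∎

  sum-supported-at₂ : ∀ {n} (f : Fin n → A) x y → x ≢ y →
                      (∀ k → k ≢ x → k ≢ y → f k ≈ 0ᴹ) → sum f ≈ f x +ᴹ f y
  sum-supported-at₂ {suc n} f x y x≢y zero-off = begin
    sum f                               ≈⟨ sum-remove f ⟩
    f x +ᴹ sum (f ∘ punchIn x)          ≈⟨ ∙-congˡ (sum-supported-at (f ∘ punchIn x) y′ zero-off-y′) ⟩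
    f x +ᴹ f (punchIn x y′)             ≡⟨ cong (λ z → f x +ᴹ f z) (FinP.punchIn-punchOut x≢y) ⟩
    f x +ᴹ f y                          ∎
    where
    y′ = punchOut x≢y
    zero-off-y′ : ∀ k → k ≢ y′ → f (punchIn x k) ≈ 0ᴹ
    zero-off-y′ k k≢y′ = zero-off _ (FinP.punchInᵢ≢i x k)
      (λ eq → k≢y′ (trans (sym (FinP.punchOut-punchIn x)) (FinP.punchOut-cong x eq)))

ℚ-semiring : Semiring 0ℓ 0ℓ
ℚ-semiring = CommutativeRing.semiring ℚP.+-*-commutativeRing

module ℚΣ = SemiringSum ℚ-semiring
module ℕΣ = SemiringSum ℕP.+-*-semiring
open ℚΣ using (sum; sum-cong-≗; sum-permute; sum-replicate-zero)
open SumSupport (Semiring.+-commutativeMonoid ℚ-semiring)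

·-as-sum : ∀ {d} (c x : Pt d) → c · x ≡ sum (λ k → c k * x k)
·-as-sum c x = foldr-tabulate (λ k → c k * x k) (λ k → k)
  where
  foldr-tabulate : ∀ {n m} (F : Fin m → ℚ) (f : Fin n → Fin m) →
                   foldr (λ k s → F k + s) 0ℚ (tabulate f) ≡ sum (F ∘ f)
  foldr-tabulate {zero}  F f = refl
  foldr-tabulate {suc n} F f = cong (F (f zero) +_) (foldr-tabulate F (f ∘ suc))

·-congʳ : ∀ {d} (c : Pt d) {x y : Pt d} → (∀ k → x k ≡ y k) → c · x ≡ c · y
·-congʳ c {x} {y} x≗y = begin
  c · x                    ≡⟨ ·-as-sum c x ⟩
  sum (λ k → c k * x k)    ≡⟨ sum-cong-≗ (cong (c _ *_) ∘ x≗y) ⟩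
  sum (λ k → c k * y k)    ≡⟨ ·-as-sum c y ⟨
  c · y                    ∎
  where open ≡-Reasoning

𝟙 : ∀ {A : Set} → Dec A → ℕ
𝟙 (yes _) = 1
𝟙 (no _)  = 0

count : ∀ {n} {P : Pred (Fin n) 0ℓ} → Decidable P → ℕ
count P? = ℕΣ.sum (λ k → 𝟙 (P? k))

count-cong : ∀ {n} {P Q : Pred (Fin n) 0ℓ} (P? : Decidable P) (Q? : Decidable Q) →
             (∀ k → P k → Q k) → (∀ k → Q k → P k) → count P? ≡ count Q?
count-cong P? Q? P⇒Q Q⇒P = ℕΣ.sum-cong-≗ λ k → same (P? k) (Q? k) (P⇒Q k) (Q⇒P k)
  where
  same : ∀ {A B : Set} (a? : Dec A) (b? : Dec B) → (A → B) → (B → A) → 𝟙 a? ≡ 𝟙 b?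
  same (yes _) (yes _) _   _   = refl
  same (no _)  (no _)  _   _   = refl
  same (yes a) (no ¬b) a⇒b _   = ⊥-elim (¬b (a⇒b a))
  same (no ¬a) (yes b) _   b⇒a = ⊥-elim (¬a (b⇒a b))

count-permute : ∀ {n} {P : Pred (Fin n) 0ℓ} (P? : Decidable P) (π : Permutation′ n) →
                count (P? ∘ (π ⟨$⟩ʳ_)) ≡ count P?
count-permute P? π = sym (ℕΣ.sum-permute (λ k → 𝟙 (P? k)) π)

count-empty : ∀ {n} {P : Pred (Fin n) 0ℓ} (P? : Decidable P) → (∀ k → ¬ P k) → count P? ≡ 0
count-empty {zero}  P? ¬P = refl
count-empty {suc n} P? ¬P with P? zero
... | yes p = ⊥-elim (¬P zero p)
... | no _  = count-empty (P? ∘ suc) (¬P ∘ suc)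

IsInitial : ∀ {n} → Pred (Fin n) 0ℓ → Set
IsInitial P = ∀ {p q} → toℕ p ℕ.≤ toℕ q → P q → P p

initial⇒<count : ∀ {n} {P : Pred (Fin n) 0ℓ} (P? : Decidable P) → IsInitial P →
                 ∀ p → P p → toℕ p ℕ.< count P?
initial⇒<count {suc n} P? initial p Pp with P? zero
... | no ¬P0 = ⊥-elim (¬P0 (initial z≤n Pp))
initial⇒<count {suc n} P? initial zero    Pp | yes _ = s≤s z≤n
initial⇒<count {suc n} P? initial (suc p) Pp | yes _ =
  s≤s (initial⇒<count (P? ∘ suc) (λ le → initial (s≤s le)) p Pp)

<count⇒initial : ∀ {n} {P : Pred (Fin n) 0ℓ} (P? : Decidable P) → IsInitial P →
                 ∀ p → toℕ p ℕ.< count P? → P p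
<count⇒initial {suc n} P? initial p p< with P? zero
... | no ¬P0 = ⊥-elim (ℕP.n≮0 (subst (toℕ p ℕ.<_) (count-empty (P? ∘ suc) (λ k Pk → ¬P0 (initial z≤n Pk))) p<))
<count⇒initial {suc n} P? initial zero    p<       | yes P0 = P0
<count⇒initial {suc n} P? initial (suc p) (s≤s p<) | yes _  =
  <count⇒initial (P? ∘ suc) (λ le → initial (s≤s le)) p p<

<⇒≱ : ∀ {p q : ℚ} → p ℚ.< q → ¬ (q ℚ.≤ p)
<⇒≱ p<q q≤p = ℚP.<-irrefl refl (ℚP.<-≤-trans p<q q≤p)

p<q⇒0<q-p : ∀ {p q : ℚ} → p ℚ.< q → 0ℚ ℚ.< q - p
p<q⇒0<q-p {p} {q} p<q = subst (ℚ._< q - p) (ℚP.+-inverseʳ p) (ℚP.+-monoˡ-< (- p) p<q)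

0<p⇒0<q⇒0<p*q : ∀ {p q : ℚ} → 0ℚ ℚ.< p → 0ℚ ℚ.< q → 0ℚ ℚ.< p * q
0<p⇒0<q⇒0<p*q {p} {q} 0<p 0<q = subst (ℚ._< p * q) (ℚP.*-zeroʳ p) (ℚP.*-monoʳ-<-pos p {{ℚ.positive 0<p}} 0<q)

ℕ→ℚ≡mkℚ : ∀ n → ℕ→ℚ n ≡ mkℚ (ℤ.+ n) 0 (Coprimality.sym (Coprimality.1-coprimeTo n))
ℕ→ℚ≡mkℚ n = ℚP.normalize-coprime (Coprimality.sym (Coprimality.1-coprimeTo n))

ℕ→ℚ-suc : ∀ n → ℕ→ℚ (suc n) ≡ 1ℚ + ℕ→ℚ n
ℕ→ℚ-suc n rewrite ℕ→ℚ≡mkℚ n = cong (λ z → (ℤ.+ 1 ℤ.+ z) / 1) (sym (ℤP.*-identityʳ (ℤ.+ n)))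

ℕ→ℚ-+ : ∀ m n → ℕ→ℚ (m ℕ.+ n) ≡ ℕ→ℚ m + ℕ→ℚ n
ℕ→ℚ-+ zero    n = sym (ℚP.+-identityˡ (ℕ→ℚ n))
ℕ→ℚ-+ (suc m) n = begin
  ℕ→ℚ (suc (m ℕ.+ n))         ≡⟨ ℕ→ℚ-suc (m ℕ.+ n) ⟩
  1ℚ + ℕ→ℚ (m ℕ.+ n)          ≡⟨ cong (1ℚ +_) (ℕ→ℚ-+ m n) ⟩
  1ℚ + (ℕ→ℚ m + ℕ→ℚ n)        ≡⟨ ℚP.+-assoc 1ℚ (ℕ→ℚ m) (ℕ→ℚ n) ⟨
  (1ℚ + ℕ→ℚ m) + ℕ→ℚ n        ≡⟨ cong (_+ ℕ→ℚ n) (ℕ→ℚ-suc m) ⟨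
  ℕ→ℚ (suc m) + ℕ→ℚ n         ∎
  where open ≡-Reasoning

ℕ→ℚ-mono-≤ : ℕ→ℚ Preserves ℕ._≤_ ⟶ ℚ._≤_
ℕ→ℚ-mono-≤ {m} {n} m≤n rewrite ℕ→ℚ≡mkℚ m | ℕ→ℚ≡mkℚ n =
  ℚ.*≤* (subst₂ ℤ._≤_ (sym (ℤP.*-identityʳ (ℤ.+ m))) (sym (ℤP.*-identityʳ (ℤ.+ n))) (ℤ.+≤+ m≤n))

ℕ→ℚ-mono-< : ℕ→ℚ Preserves ℕ._<_ ⟶ ℚ._<_
ℕ→ℚ-mono-< {m} {n} m<n rewrite ℕ→ℚ≡mkℚ m | ℕ→ℚ≡mkℚ n =
  ℚ.*<* (subst₂ ℤ._<_ (sym (ℤP.*-identityʳ (ℤ.+ m))) (sym (ℤP.*-identityʳ (ℤ.+ n))) (ℤ.+<+ m<n))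

ℕ→ℚ-cancel-≤ : ∀ {m n} → ℕ→ℚ m ℚ.≤ ℕ→ℚ n → m ℕ.≤ n
ℕ→ℚ-cancel-≤ m≤n = ℕP.≮⇒≥ λ n<m → <⇒≱ (ℕ→ℚ-mono-< n<m) m≤n

ℕ→ℚ-cancel-< : ∀ {m n} → ℕ→ℚ m ℚ.< ℕ→ℚ n → m ℕ.< n
ℕ→ℚ-cancel-< m<n = ℕP.≰⇒> λ n≤m → <⇒≱ m<n (ℕ→ℚ-mono-≤ n≤m)

-- Sorting permutations and the rearrangement inequality

argmaxFin : ∀ {m} (h : Fin (suc m) → ℚ) → ∃ λ j → ∀ i → h i ℚ.≤ h j
argmaxFin {zero}  h = zero , λ { zero → ℚP.≤-refl }
argmaxFin {suc m} h with argmaxFin (h ∘ suc)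
... | j , ub with h zero ℚP.≤? h (suc j)
...   | yes h0≤ = suc j , λ { zero → h0≤ ; (suc i) → ub i }
...   | no h0≰  = zero  , λ { zero → ℚP.≤-refl ; (suc i) → ℚP.≤-trans (ub i) (ℚP.<⇒≤ (ℚP.≰⇒> h0≰)) }

insert-zero-cong : ∀ {m} j {ρ ρ′ : Permutation′ m} → ρ Perm.≈ ρ′ → insert zero j ρ Perm.≈ insert zero j ρ′
insert-zero-cong j         ρ≈ρ′ zero    = refl
insert-zero-cong j {ρ} {ρ′} ρ≈ρ′ (suc k) = begin
  insert zero j ρ ⟨$⟩ʳ suc k    ≡⟨ Perm.insert-punchIn zero j ρ k ⟩
  punchIn j (ρ ⟨$⟩ʳ k)          ≡⟨ cong (punchIn j) (ρ≈ρ′ k) ⟩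
  punchIn j (ρ′ ⟨$⟩ʳ k)         ≡⟨ Perm.insert-punchIn zero j ρ′ k ⟨
  insert zero j ρ′ ⟨$⟩ʳ suc k   ∎
  where open ≡-Reasoning

-- Induction on m, writing each π as insert zero (π 0) (remove zero π).
argmaxPerm : ∀ {m} (F : Permutation′ m → ℚ) → (∀ {π ρ} → π Perm.≈ ρ → F π ≡ F ρ) →
             ∃ λ π* → ∀ π → F π ℚ.≤ F π*
argmaxPerm {zero}  F F-cong = Perm.id , λ π → ℚP.≤-reflexive (F-cong (λ ()))
argmaxPerm {suc m} F F-cong = insert zero j* (best j*) , F≤
  where
  F′ : Fin (suc m) → Permutation′ m → ℚ
  F′ j ρ = F (insert zero j ρ)
  best-for : ∀ j → ∃ λ ρ* → ∀ ρ → F′ j ρ ℚ.≤ F′ j ρ*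
  best-for j = argmaxPerm (F′ j) (F-cong ∘ insert-zero-cong j)
  best : Fin (suc m) → Permutation′ m
  best j = proj₁ (best-for j)
  j* = proj₁ (argmaxFin (λ j → F′ j (best j)))
  F≤ : ∀ π → F π ℚ.≤ F′ j* (best j*)
  F≤ π = begin
    F π                                   ≡⟨ F-cong (Perm.insert-remove zero π) ⟨
    F′ (π ⟨$⟩ʳ zero) (remove zero π)       ≤⟨ proj₂ (best-for _) (remove zero π) ⟩
    F′ (π ⟨$⟩ʳ zero) (best (π ⟨$⟩ʳ zero))  ≤⟨ proj₂ (argmaxFin (λ j → F′ j (best j))) (π ⟨$⟩ʳ zero) ⟩
    F′ j* (best j*)                       ∎
    where open ℚP.≤-Reasoning

⟨$⟩ʳ-injective : ∀ {n} (π : Permutation′ n) {x y} → π ⟨$⟩ʳ x ≡ π ⟨$⟩ʳ y → x ≡ y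
⟨$⟩ʳ-injective π {x} {y} eq = trans (sym (inverseˡ π)) (trans (cong (π ⟨$⟩ˡ_) eq) (inverseˡ π))

Sorts : ∀ {d} → Pt d → Permutation′ d → Set
Sorts c π = ∀ x y → c x ℚ.< c y → π ⟨$⟩ʳ x Fin.< π ⟨$⟩ʳ y

sorted : ∀ {d} → Pt d → Permutation′ d → Fin d → ℚ
sorted c π p = c (π ⟨$⟩ˡ p)

sorted-mono : ∀ {d} (c : Pt d) π → Sorts c π →
              ∀ {p q} → toℕ p ℕ.≤ toℕ q → sorted c π p ℚ.≤ sorted c π q
sorted-mono c π π-sorts p≤q = ℚP.≮⇒≥ λ lt →
  ℕP.<⇒≱ (subst₂ Fin._<_ (inverseʳ π) (inverseʳ π) (π-sorts _ _ lt)) p≤q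

-- Both sorted sequences have exactly count {x | c x ≤ t} entries ≤ t, for every t.
sorted-unique : ∀ {d} (c : Pt d) π π′ → Sorts c π → Sorts c π′ → ∀ p → sorted c π p ≡ sorted c π′ p
sorted-unique c π π′ π-sorts π′-sorts p =
  ℚP.≤-antisym (≤-by π π′ π-sorts π′-sorts) (≤-by π′ π π′-sorts π-sorts)
  where
  ≤-by : ∀ σ σ′ → Sorts c σ → Sorts c σ′ → sorted c σ p ℚ.≤ sorted c σ′ p
  ≤-by σ σ′ σ-sorts σ′-sorts =
    <count⇒initial (≤t? σ) (initial σ σ-sorts) p
      (subst (toℕ p ℕ.<_) (trans (count-≤t σ′) (sym (count-≤t σ)))
        (initial⇒<count (≤t? σ′) (initial σ′ σ′-sorts) p ℚP.≤-refl))
    where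
    t = sorted c σ′ p
    ≤t? : ∀ τ → Decidable (λ q → sorted c τ q ℚ.≤ t)
    ≤t? τ q = sorted c τ q ℚP.≤? t
    initial : ∀ τ → Sorts c τ → IsInitial (λ q → sorted c τ q ℚ.≤ t)
    initial τ τ-sorts p≤q = ℚP.≤-trans (sorted-mono c τ τ-sorts p≤q)
    count-≤t : ∀ τ → count (≤t? τ) ≡ count (λ x → c x ℚP.≤? t)
    count-≤t τ = trans (sym (count-permute (≤t? τ) τ))
      (count-cong (≤t? τ ∘ (τ ⟨$⟩ʳ_)) (λ x → c x ℚP.≤? t) (λ x → subst (ℚ._≤ t) (cong c (inverseˡ τ)))
                      (λ x → subst (ℚ._≤ t) (cong c (sym (inverseˡ τ)))))

·-permuted≡sorted : ∀ {d} (c g : Pt d) π → c · (g ∘ (π ⟨$⟩ʳ_)) ≡ sum (λ p → sorted c π p * g p)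
·-permuted≡sorted c g π = begin
  c · (g ∘ (π ⟨$⟩ʳ_))                              ≡⟨ ·-as-sum c _ ⟩
  sum (λ k → c k * g (π ⟨$⟩ʳ k))                   ≡⟨ sum-permute _ (flip π) ⟩
  sum (λ p → c (π ⟨$⟩ˡ p) * g (π ⟨$⟩ʳ (π ⟨$⟩ˡ p)))
    ≡⟨ sum-cong-≗ (λ p → cong (λ z → sorted c π p * g z) (inverseʳ π)) ⟩
  sum (λ p → sorted c π p * g p)                   ∎
  where open ≡-Reasoning

·-permuted-cong : ∀ {d} (c g : Pt d) {π ρ} → π Perm.≈ ρ → c · (g ∘ (π ⟨$⟩ʳ_)) ≡ c · (g ∘ (ρ ⟨$⟩ʳ_))
·-permuted-cong c g π≈ρ = ·-congʳ c (cong g ∘ π≈ρ)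

transpose-at-i : ∀ {n} (i j : Fin n) → PC.transpose i j i ≡ j
transpose-at-i i j rewrite dec-true (i FinP.≟ i) refl = refl

transpose-at-j : ∀ {n} (i j : Fin n) → PC.transpose i j j ≡ i
transpose-at-j i j with j FinP.≟ i
... | yes j≡i = j≡i
... | no _ rewrite dec-true (j FinP.≟ j) refl = refl

transpose-elsewhere : ∀ {n} {i j k : Fin n} → k ≢ i → k ≢ j → PC.transpose i j k ≡ k
transpose-elsewhere {i = i} {j} {k} k≢i k≢j
  rewrite dec-false (k FinP.≟ i) k≢i | dec-false (k FinP.≟ j) k≢j = refl

transpose-invariant : ∀ {d} (c : Pt d) {x y} → c x ≡ c y → ∀ k → c (PC.transpose x y k) ≡ c k
transpose-invariant c {x} {y} cx≡cy k = by-cases (k FinP.≟ x) (k FinP.≟ y)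
  where
  by-cases : Dec (k ≡ x) → Dec (k ≡ y) → c (PC.transpose x y k) ≡ c k
  by-cases (yes k≡x) _ = begin
    c (PC.transpose x y k)  ≡⟨ cong (c ∘ PC.transpose x y) k≡x ⟩
    c (PC.transpose x y x)  ≡⟨ cong c (transpose-at-i x y) ⟩
    c y                     ≡⟨ cx≡cy ⟨
    c x                     ≡⟨ cong c k≡x ⟨
    c k                     ∎
    where open ≡-Reasoning
  by-cases (no _) (yes k≡y) = begin
    c (PC.transpose x y k)  ≡⟨ cong (c ∘ PC.transpose x y) k≡y ⟩
    c (PC.transpose x y y)  ≡⟨ cong c (transpose-at-j x y) ⟩
    c x                     ≡⟨ cx≡cy ⟩
    c y                     ≡⟨ cong c k≡y ⟨
    c k                     ∎
    where open ≡-Reasoning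
  by-cases (no k≢x) (no k≢y) = cong c (transpose-elsewhere k≢x k≢y)

·-permuted-transpose : ∀ {d} (c g : Pt d) π x y → x ≢ y →
  c · (g ∘ ((transpose x y ∘ₚ π) ⟨$⟩ʳ_)) ≡
  c · (g ∘ (π ⟨$⟩ʳ_)) + (c x - c y) * (g (π ⟨$⟩ʳ y) - g (π ⟨$⟩ʳ x))
·-permuted-transpose c g π x y x≢y = begin
  c · (g ∘ ((transpose x y ∘ₚ π) ⟨$⟩ʳ_))       ≡⟨ ·-as-sum c _ ⟩
  sum u                                       ≡⟨ sum-cong-≗ (λ k → solve 2 (λ u v → u := v :+ (u :- v)) refl (u k) (v k)) ⟩
  sum (λ k → v k + (u k - v k))               ≡⟨ ℚΣ.∑-distrib-+ v (λ k → u k - v k) ⟩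
  sum v + sum (λ k → u k - v k)
    ≡⟨ cong₂ _+_ (sym (·-as-sum c _)) (sum-supported-at₂ _ x y x≢y u≡v-elsewhere) ⟩
  V + ((u x - v x) + (u y - v y))             ≡⟨ cong (λ z → V + z) (cong₂ (λ s t → (s - v x) + (t - v y)) u-at-x u-at-y) ⟩
  V + ((c x * gπ y - c x * gπ x) + (c y * gπ x - c y * gπ y))
    ≡⟨ cong (V +_) (solve 4 (λ cx cy gx gy → (cx :* gy :- cx :* gx) :+ (cy :* gx :- cy :* gy) := (cx :- cy) :* (gy :- gx))
                           refl (c x) (c y) (gπ x) (gπ y)) ⟩
  V + (c x - c y) * (gπ y - gπ x)             ∎
  where
  open ≡-Reasoning
  open ℚ-Solver
  gπ : Fin _ → ℚ
  gπ k = g (π ⟨$⟩ʳ k)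
  V = c · (g ∘ (π ⟨$⟩ʳ_))
  u v : Pt _
  u k = c k * gπ (PC.transpose x y k)
  v k = c k * gπ k
  u-at-x : u x ≡ c x * gπ y
  u-at-x = cong (λ z → c x * gπ z) (transpose-at-i x y)
  u-at-y : u y ≡ c y * gπ x
  u-at-y = cong (λ z → c y * gπ z) (transpose-at-j x y)
  u≡v-elsewhere : ∀ k → k ≢ x → k ≢ y → u k - v k ≡ 0ℚ
  u≡v-elsewhere k k≢x k≢y rewrite transpose-elsewhere k≢x k≢y = ℚP.+-inverseʳ (v k)

-- The exchange argument: swapping an inversion strictly increases the value.
maximiser-sorts : ∀ {d} (c g : Pt d) → g Preserves Fin._<_ ⟶ ℚ._<_ → ∀ π →
                  (∀ σ → c · (g ∘ (σ ⟨$⟩ʳ_)) ℚ.≤ c · (g ∘ (π ⟨$⟩ʳ_))) → Sorts c π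
maximiser-sorts c g g-inc π maximal x y cx<cy with FinP.<-cmp (π ⟨$⟩ʳ x) (π ⟨$⟩ʳ y)
... | tri< πx<πy _ _ = πx<πy
... | tri≈ _ πx≡πy _ = ⊥-elim (ℚP.<-irrefl (cong c (⟨$⟩ʳ-injective π πx≡πy)) cx<cy)
... | tri> _ _ πy<πx = ⊥-elim (<⇒≱ larger (maximal (transpose x y ∘ₚ π)))
  where
  open ℚ-Solver
  x≢y : x ≢ y
  x≢y x≡y = ℚP.<-irrefl (cong c x≡y) cx<cy
  0<gain : 0ℚ ℚ.< (c x - c y) * (g (π ⟨$⟩ʳ y) - g (π ⟨$⟩ʳ x))
  0<gain = subst (0ℚ ℚ.<_)
    (solve 4 (λ a b p q → (b :- a) :* (q :- p) := (a :- b) :* (p :- q)) refl (c x) (c y) (g (π ⟨$⟩ʳ y)) (g (π ⟨$⟩ʳ x)))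
    (0<p⇒0<q⇒0<p*q (p<q⇒0<q-p cx<cy) (p<q⇒0<q-p (g-inc πy<πx)))
  larger : c · (g ∘ (π ⟨$⟩ʳ_)) ℚ.< c · (g ∘ ((transpose x y ∘ₚ π) ⟨$⟩ʳ_))
  larger = subst₂ ℚ._<_ (ℚP.+-identityʳ _) (sym (·-permuted-transpose c g π x y x≢y))
    (ℚP.+-monoʳ-< (c · (g ∘ (π ⟨$⟩ʳ_))) 0<gain)

module _ {d} (c g : Pt d) (g-inc : g Preserves Fin._<_ ⟶ ℚ._<_) where

  sorting-maximiser : ∃ λ π* → Sorts c π* × (∀ π → c · (g ∘ (π ⟨$⟩ʳ_)) ℚ.≤ c · (g ∘ (π* ⟨$⟩ʳ_)))
  sorting-maximiser with argmaxPerm (λ π → c · (g ∘ (π ⟨$⟩ʳ_))) (λ {π} {ρ} → ·-permuted-cong c g {π} {ρ})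
  ... | π* , maximal = π* , maximiser-sorts c g g-inc π* maximal , maximal

  sorting-value-unique : ∀ π π′ → Sorts c π → Sorts c π′ → c · (g ∘ (π ⟨$⟩ʳ_)) ≡ c · (g ∘ (π′ ⟨$⟩ʳ_))
  sorting-value-unique π π′ π-sorts π′-sorts = begin
    c · (g ∘ (π ⟨$⟩ʳ_))             ≡⟨ ·-permuted≡sorted c g π ⟩
    sum (λ p → sorted c π p * g p)  ≡⟨ sum-cong-≗ (λ p → cong (_* g p) (sorted-unique c π π′ π-sorts π′-sorts p)) ⟩
    sum (λ p → sorted c π′ p * g p) ≡⟨ ·-permuted≡sorted c g π′ ⟨
    c · (g ∘ (π′ ⟨$⟩ʳ_))            ∎
    where open ≡-Reasoning

  rearrangement : ∀ σ → Sorts c σ → ∀ π → c · (g ∘ (π ⟨$⟩ʳ_)) ℚ.≤ c · (g ∘ (σ ⟨$⟩ʳ_))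
  rearrangement σ σ-sorts π with sorting-maximiser
  ... | π* , π*-sorts , maximal =
    ℚP.≤-trans (maximal π) (ℚP.≤-reflexive (sorting-value-unique π* σ π*-sorts σ-sorts))

opaque
  sortPerm : ∀ {d} → Pt d → Permutation′ d
  sortPerm c = proj₁ (sorting-maximiser c (ℕ→ℚ ∘ toℕ) ℕ→ℚ-mono-<)

  sortPerm-sorts : ∀ {d} (c : Pt d) → Sorts c (sortPerm c)
  sortPerm-sorts c = proj₁ (proj₂ (sorting-maximiser c (ℕ→ℚ ∘ toℕ) ℕ→ℚ-mono-<))

sorting-separates : ∀ {d} (c : Pt d) x y → c x ℚ.≤ c y → x ≢ y →
                    ∃ λ ρ → Sorts c ρ × ρ ⟨$⟩ʳ x Fin.< ρ ⟨$⟩ʳ y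
sorting-separates c x y cx≤cy x≢y with c x ℚP.<? c y | FinP.<-cmp (sortPerm c ⟨$⟩ʳ x) (sortPerm c ⟨$⟩ʳ y)
... | yes cx<cy | _              = sortPerm c , sortPerm-sorts c , sortPerm-sorts c x y cx<cy
... | no _      | tri< σx<σy _ _ = sortPerm c , sortPerm-sorts c , σx<σy
... | no _      | tri≈ _ σx≡σy _ = ⊥-elim (x≢y (⟨$⟩ʳ-injective (sortPerm c) σx≡σy))
... | no cx≮cy  | tri> _ _ σy<σx = ρ , ρ-sorts ,
      subst₂ Fin._<_ (cong (sortPerm c ⟨$⟩ʳ_) (sym (transpose-at-i x y)))
                     (cong (sortPerm c ⟨$⟩ʳ_) (sym (transpose-at-j x y))) σy<σx
  where
  ρ = transpose x y ∘ₚ sortPerm c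
  cx≡cy = ℚP.≤-antisym cx≤cy (ℚP.≮⇒≥ cx≮cy)
  ρ-sorts : Sorts c ρ
  ρ-sorts a b ca<cb = sortPerm-sorts c _ _
    (subst₂ ℚ._<_ (sym (transpose-invariant c cx≡cy a)) (sym (transpose-invariant c cx≡cy b)) ca<cb)

-- The vertices of 𝔖_d(P)

e-on : ∀ d i (k : Fin d) → toℕ k ≡ i → e d i k ≡ 1ℚ
e-on d i k k≡i with toℕ k ℕP.≟ i
... | yes _  = refl
... | no k≢i = ⊥-elim (k≢i k≡i)

e-off : ∀ d i (k : Fin d) → toℕ k ≢ i → e d i k ≡ 0ℚ
e-off d i k k≢i with toℕ k ℕP.≟ i
... | yes k≡i = ⊥-elim (k≢i k≡i)
... | no _    = refl

a-bounds : ∀ d i k → - 1ℚ ℚ.≤ a d i k × a d i k ℚ.≤ 1ℚ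
a-bounds d i k with toℕ k ℕP.≟ i | toℕ k ℕP.≟ suc i
... | yes _ | yes _ = toWitness {a? = - 1ℚ ℚP.≤? (- 1ℚ + 1ℚ)} _ , toWitness {a? = (- 1ℚ + 1ℚ) ℚP.≤? 1ℚ} _
... | yes _ | no _  = toWitness {a? = - 1ℚ ℚP.≤? (- 1ℚ + 0ℚ)} _ , toWitness {a? = (- 1ℚ + 0ℚ) ℚP.≤? 1ℚ} _
... | no _  | yes _ = toWitness {a? = - 1ℚ ℚP.≤? (- 0ℚ + 1ℚ)} _ , toWitness {a? = (- 0ℚ + 1ℚ) ℚP.≤? 1ℚ} _
... | no _  | no _  = toWitness {a? = - 1ℚ ℚP.≤? (- 0ℚ + 0ℚ)} _ , toWitness {a? = (- 0ℚ + 0ℚ) ℚP.≤? 1ℚ} _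

generator : ∀ {m} → Fin m → Pt (suc m)
generator {m} i p = γ₀ (suc m) p + a (suc m) (toℕ i) p

squares-apart : ∀ {p q} → p ℕ.< q → 2 ℕ.+ suc p ℕ.^ 2 ℕ.< suc q ℕ.^ 2
squares-apart {p} p<q = ℕP.≤-trans (ℕP.≤-trans (s≤s (s≤s (s≤s (ℕP.m≤m+n (suc p ℕ.^ 2) (2 ℕ.* p)))))
                                               (ℕP.≤-reflexive expand))
                                   (ℕP.^-monoˡ-≤ 2 (s≤s p<q))
  where
  open ℕ-Solver.+-*-Solver
  expand : 3 ℕ.+ (suc p ℕ.^ 2 ℕ.+ 2 ℕ.* p) ≡ suc (suc p) ℕ.^ 2
  expand = solve 1 (λ x → con 3 :+ ((con 1 :+ x) :^ 2 :+ con 2 :* x) := (con 2 :+ x) :^ 2) refl p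

-- a_{i+1} moves each coordinate by at most 1, while distinct squares differ by at least 3.
generator-strictlyIncreasing : ∀ {m} (i : Fin m) → generator i Preserves Fin._<_ ⟶ ℚ._<_
generator-strictlyIncreasing {m} i {p} {q} p<q = begin-strict
  generator i p         ≤⟨ ℚP.+-monoʳ-≤ (ℕ→ℚ A) (proj₂ (a-bounds _ _ p)) ⟩
  ℕ→ℚ A + 1ℚ            ≡⟨ solve 1 (λ x → x :+ con 1ℚ := ((x :+ con 1ℚ) :+ con 1ℚ) :- con 1ℚ) refl (ℕ→ℚ A) ⟩
  ((ℕ→ℚ A + 1ℚ) + 1ℚ) - 1ℚ
    <⟨ ℚP.+-monoˡ-< (- 1ℚ) (subst (ℚ._< ℕ→ℚ B) A+2≡ (ℕ→ℚ-mono-< (squares-apart p<q))) ⟩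
  ℕ→ℚ B - 1ℚ            ≤⟨ ℚP.+-monoʳ-≤ (ℕ→ℚ B) (proj₁ (a-bounds _ _ q)) ⟩
  generator i q         ∎
  where
  open ℚP.≤-Reasoning
  open ℚ-Solver
  A = suc (toℕ p) ℕ.^ 2
  B = suc (toℕ q) ℕ.^ 2
  A+2≡ : ℕ→ℚ (suc (suc A)) ≡ (ℕ→ℚ A + 1ℚ) + 1ℚ
  A+2≡ = trans (ℕ→ℚ-suc (suc A)) (trans (cong (1ℚ +_) (ℕ→ℚ-suc A))
           (solve 1 (λ x → con 1ℚ :+ (con 1ℚ :+ x) := (x :+ con 1ℚ) :+ con 1ℚ) refl (ℕ→ℚ A)))

vertex : ∀ {m} → Fin m → Permutation′ (suc m) → Pt (suc m)
vertex i π = generator i ∘ (π ⟨$⟩ʳ_)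

baseline : ∀ {d} → (Fin d → ℚ) → ℚ
baseline {d} s = sum (λ p → s p * γ₀ d p)

gap : ∀ {m} → (Fin (suc m) → ℚ) → Fin m → ℚ
gap s i = s (suc i) - s (inject₁ i)

sum-*-a : ∀ {m} (s : Fin (suc m) → ℚ) (i : Fin m) → sum (λ p → s p * a (suc m) (toℕ i) p) ≡ gap s i
sum-*-a {m} s i = begin
  sum (λ p → s p * a′ p)
    ≡⟨ sum-supported-at₂ _ (inject₁ i) (suc i) inject₁≢suc a′-elsewhere ⟩
  s (inject₁ i) * a′ (inject₁ i) + s (suc i) * a′ (suc i)
    ≡⟨ cong₂ (λ u v → s (inject₁ i) * u + s (suc i) * v) a′-at-i a′-at-1+i ⟩
  s (inject₁ i) * (- 1ℚ + 0ℚ) + s (suc i) * (- 0ℚ + 1ℚ)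
    ≡⟨ solve 2 (λ x y → x :* (:- con 1ℚ :+ con 0ℚ) :+ y :* (:- con 0ℚ :+ con 1ℚ) := y :- x)
               refl (s (inject₁ i)) (s (suc i)) ⟩
  gap s i
    ∎
  where
  open ≡-Reasoning
  open ℚ-Solver
  a′ = a (suc m) (toℕ i)
  e-i e-1+i : Fin (suc m) → ℚ
  e-i = e (suc m) (toℕ i)
  e-1+i = e (suc m) (suc (toℕ i))
  inject₁≢suc : inject₁ i ≢ suc i
  inject₁≢suc eq = ℕP.1+n≢n (sym (trans (sym (FinP.toℕ-inject₁ i)) (cong toℕ eq)))
  a′-at-i : a′ (inject₁ i) ≡ - 1ℚ + 0ℚ
  a′-at-i = cong₂ (λ u v → - u + v) (e-on _ _ _ (FinP.toℕ-inject₁ i))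
                                    (e-off _ _ _ (λ eq → ℕP.1+n≢n (trans (sym eq) (FinP.toℕ-inject₁ i))))
  a′-at-1+i : a′ (suc i) ≡ - 0ℚ + 1ℚ
  a′-at-1+i = cong₂ (λ u v → - u + v) (e-off _ _ (suc i) ℕP.1+n≢n) (e-on _ _ (suc i) refl)
  a′-elsewhere : ∀ k → k ≢ inject₁ i → k ≢ suc i → s k * a′ k ≡ 0ℚ
  a′-elsewhere k k≢i k≢1+i = begin
    s k * (- e-i k + e-1+i k)
      ≡⟨ cong₂ (λ u v → s k * (- u + v)) (e-off _ _ k (k≢i ∘ toℕ≡i⇒)) (e-off _ _ k (k≢1+i ∘ FinP.toℕ-injective)) ⟩
    s k * (- 0ℚ + 0ℚ)          ≡⟨ ℚP.*-zeroʳ (s k) ⟩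
    0ℚ                         ∎
    where
    toℕ≡i⇒ : toℕ k ≡ toℕ i → k ≡ inject₁ i
    toℕ≡i⇒ eq = FinP.toℕ-injective (trans eq (sym (FinP.toℕ-inject₁ i)))

·-vertex : ∀ {m} (c : Pt (suc m)) i π → c · vertex i π ≡ baseline (sorted c π) + gap (sorted c π) i
·-vertex {m} c i π = begin
  c · vertex i π                                ≡⟨ ·-permuted≡sorted c (generator i) π ⟩
  sum (λ p → s p * (γ p + a′ p))                ≡⟨ sum-cong-≗ (λ p → ℚP.*-distribˡ-+ (s p) (γ p) (a′ p)) ⟩
  sum (λ p → s p * γ p + s p * a′ p)            ≡⟨ ℚΣ.∑-distrib-+ (λ p → s p * γ p) (λ p → s p * a′ p) ⟩
  baseline s + sum (λ p → s p * a′ p)           ≡⟨ cong (baseline s +_) (sum-*-a s i) ⟩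
  baseline s + gap s i                          ∎
  where
  open ≡-Reasoning
  s = sorted c π
  γ = γ₀ (suc m)
  a′ = a (suc m) (toℕ i)

-- Optimal vertices and supporting faces

module _ {n} (c : Pt (suc (suc n))) where

  gaps : Fin (suc n) → ℚ
  gaps = gap (sorted c (sortPerm c))

  opaque
    maxGapIndex : Fin (suc n)
    maxGapIndex = proj₁ (argmaxFin gaps)

    gap≤gap-maxGapIndex : ∀ i → gaps i ℚ.≤ gaps maxGapIndex
    gap≤gap-maxGapIndex = proj₂ (argmaxFin gaps)

  maxGap : ℚ
  maxGap = gaps maxGapIndex

  gap≤maxGap : ∀ i → gaps i ℚ.≤ maxGap
  gap≤maxGap = gap≤gap-maxGapIndex

  MaxGap : Pred (Fin (suc n)) _
  MaxGap i = gaps i ≡ maxGap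

  maxGap? : Decidable MaxGap
  maxGap? i = gaps i ℚP.≟ maxGap

  base : ℚ
  base = baseline (sorted c (sortPerm c))

  optimum : ℚ
  optimum = base + maxGap

  ·-sorting-vertex : ∀ i π → Sorts c π → c · vertex i π ≡ base + gaps i
  ·-sorting-vertex i π π-sorts =
    trans (sorting-value-unique c (generator i) (generator-strictlyIncreasing i) π (sortPerm c) π-sorts (sortPerm-sorts c))
          (·-vertex c i (sortPerm c))

  vertex≤optimum : ∀ i π → c · vertex i π ℚ.≤ optimum
  vertex≤optimum i π = begin
    c · vertex i π
      ≤⟨ rearrangement c (generator i) (generator-strictlyIncreasing i) (sortPerm c) (sortPerm-sorts c) π ⟩
    c · vertex i (sortPerm c)   ≡⟨ ·-sorting-vertex i (sortPerm c) (sortPerm-sorts c) ⟩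
    base + gaps i               ≤⟨ ℚP.+-monoʳ-≤ base (gap≤maxGap i) ⟩
    optimum                     ∎
    where open ℚP.≤-Reasoning

  optimal⇒sorts×maxGap : ∀ i π → c · vertex i π ≡ optimum → Sorts c π × MaxGap i
  optimal⇒sorts×maxGap i π optimal = π-sorts , ∙-cancelˡ base _ _ (trans (sym (·-sorting-vertex i π π-sorts)) optimal)
    where
    π-sorts = maximiser-sorts c (generator i) (generator-strictlyIncreasing i) π
                (λ σ → ℚP.≤-trans (vertex≤optimum i σ) (ℚP.≤-reflexive (sym optimal)))

  sorts×maxGap⇒optimal : ∀ i π → Sorts c π → MaxGap i → c · vertex i π ≡ optimum
  sorts×maxGap⇒optimal i π π-sorts max = trans (·-sorting-vertex i π π-sorts) (cong (base +_) max)

  optimal-vertex : c · vertex maxGapIndex (sortPerm c) ≡ optimum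
  optimal-vertex = sorts×maxGap⇒optimal maxGapIndex (sortPerm c) (sortPerm-sorts c) refl

combination : ∀ {d} → List (ℚ × Pt d) → Pt d
combination L k = foldr (λ p s → proj₁ p * proj₂ p k + s) 0ℚ L

totalWeight : ∀ {A : Set} → List (ℚ × A) → ℚ
totalWeight = foldr (λ p s → proj₁ p + s) 0ℚ

weightedSum : ∀ {A : Set} → List (ℚ × A) → (A → ℚ) → ℚ
weightedSum L F = foldr (λ p s → proj₁ p * F (proj₂ p) + s) 0ℚ L

·-combination : ∀ {d} (c : Pt d) L → c · combination L ≡ weightedSum L (c ·_)
·-combination {d} c [] = begin
  c · (λ _ → 0ℚ)            ≡⟨ ·-as-sum c _ ⟩
  sum (λ k → c k * 0ℚ)      ≡⟨ sum-cong-≗ (λ k → ℚP.*-zeroʳ (c k)) ⟩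
  sum {d} (λ _ → 0ℚ)        ≡⟨ sum-replicate-zero d ⟩
  0ℚ                        ∎
  where open ≡-Reasoning
·-combination c ((w , y) ∷ L) = begin
  c · (λ k → w * y k + R k)
    ≡⟨ ·-as-sum c _ ⟩
  sum (λ k → c k * (w * y k + R k))
    ≡⟨ sum-cong-≗ (λ k → distribute (c k) (y k) (R k)) ⟩
  sum (λ k → w * (c k * y k) + c k * R k)
    ≡⟨ ℚΣ.∑-distrib-+ (λ k → w * (c k * y k)) (λ k → c k * R k) ⟩
  sum (λ k → w * (c k * y k)) + sum (λ k → c k * R k)
    ≡⟨ cong₂ _+_ (ℚΣ.*-distribˡ-sum w (λ k → c k * y k)) (·-as-sum c R) ⟨
  w * sum (λ k → c k * y k) + c · R
    ≡⟨ cong₂ (λ u v → w * u + v) (sym (·-as-sum c y)) (·-combination c L) ⟩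
  w * (c · y) + weightedSum L (c ·_)
    ∎
  where
  open ≡-Reasoning
  R = combination L
  distribute : ∀ ck yk rk → ck * (w * yk + rk) ≡ w * (ck * yk) + ck * rk
  distribute = solve 4 (λ w ck yk rk → ck :* (w :* yk :+ rk) := w :* (ck :* yk) :+ ck :* rk) refl w
    where open ℚ-Solver

≤-+-≡⇒≡ : ∀ {p q r s : ℚ} → p ℚ.≤ q → r ℚ.≤ s → p + r ≡ q + s → p ≡ q × r ≡ s
≤-+-≡⇒≡ {p} {q} {r} {s} p≤q r≤s sum≡ with ℚP.<-cmp p q | ℚP.<-cmp r s
... | tri< p<q _ _ | _            = ⊥-elim (ℚP.<-irrefl sum≡ (ℚP.+-mono-<-≤ p<q r≤s))
... | tri> _ _ q<p | _            = ⊥-elim (<⇒≱ q<p p≤q)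
... | tri≈ _ _ _   | tri< r<s _ _ = ⊥-elim (ℚP.<-irrefl sum≡ (ℚP.+-mono-≤-< p≤q r<s))
... | tri≈ _ _ _   | tri> _ _ s<r = ⊥-elim (<⇒≱ s<r r≤s)
... | tri≈ _ p≡q _ | tri≈ _ r≡s _ = p≡q , r≡s

*-≤-≡⇒ : ∀ {w f m : ℚ} → 0ℚ ℚ.≤ w → f ℚ.≤ m → w * f ≡ w * m → w ≡ 0ℚ ⊎ f ≡ m
*-≤-≡⇒ {w} {f} {m} 0≤w f≤m eq with ℚP.<-cmp 0ℚ w | ℚP.<-cmp f m
... | tri≈ _ 0≡w _ | _            = inj₁ (sym 0≡w)
... | tri> _ _ w<0 | _            = ⊥-elim (<⇒≱ w<0 0≤w)
... | tri< _ _ _   | tri≈ _ f≡m _ = inj₂ f≡m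
... | tri< _ _ _   | tri> _ _ m<f = ⊥-elim (<⇒≱ m<f f≤m)
... | tri< 0<w _ _ | tri< f<m _ _ = ⊥-elim (ℚP.<-irrefl eq (ℚP.*-monoʳ-<-pos w {{ℚ.positive 0<w}} f<m))

module _ {A : Set} (F : A → ℚ) (M : ℚ) where

  WeightedAtMost : ℚ × A → Set
  WeightedAtMost (w , y) = 0ℚ ℚ.≤ w × F y ℚ.≤ M

  WeightlessOrAt : ℚ × A → Set
  WeightlessOrAt (w , y) = w ≡ 0ℚ ⊎ F y ≡ M

  w*Fy≤w*M : ∀ {w y} → 0ℚ ℚ.≤ w → F y ℚ.≤ M → w * F y ℚ.≤ w * M
  w*Fy≤w*M {w} 0≤w = ℚP.*-monoˡ-≤-nonNeg w {{ℚ.nonNegative 0≤w}}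

  weightedSum-≤ : ∀ L → All WeightedAtMost L → weightedSum L F ℚ.≤ M * totalWeight L
  weightedSum-≤ []            []                  = ℚP.≤-reflexive (sym (ℚP.*-zeroʳ M))
  weightedSum-≤ ((w , y) ∷ L) ((0≤w , Fy≤M) ∷ ok) = begin
    w * F y + weightedSum L F        ≤⟨ ℚP.+-mono-≤ (w*Fy≤w*M 0≤w Fy≤M) (weightedSum-≤ L ok) ⟩
    w * M + M * totalWeight L        ≡⟨ cong (_+ M * totalWeight L) (ℚP.*-comm w M) ⟩
    M * w + M * totalWeight L        ≡⟨ ℚP.*-distribˡ-+ M w (totalWeight L) ⟨
    M * (w + totalWeight L)          ∎
    where open ℚP.≤-Reasoning

  weightedSum-≡⇒ : ∀ L → All WeightedAtMost L → weightedSum L F ≡ M * totalWeight L → All WeightlessOrAt L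
  weightedSum-≡⇒ []            []                  _  = []
  weightedSum-≡⇒ ((w , y) ∷ L) ((0≤w , Fy≤M) ∷ ok) eq =
    *-≤-≡⇒ 0≤w Fy≤M (trans head≡ (ℚP.*-comm M w)) ∷ weightedSum-≡⇒ L ok tail≡
    where
    split = ≤-+-≡⇒≡ (ℚP.≤-trans (w*Fy≤w*M 0≤w Fy≤M) (ℚP.≤-reflexive (ℚP.*-comm w M)))
                    (weightedSum-≤ L ok)
                    (trans eq (ℚP.*-distribˡ-+ M w (totalWeight L)))
    head≡ = proj₁ split
    tail≡ = proj₂ split

  weightedSum-≡⇐ : ∀ L → All WeightlessOrAt L → weightedSum L F ≡ M * totalWeight L
  weightedSum-≡⇐ []            []           = sym (ℚP.*-zeroʳ M)
  weightedSum-≡⇐ ((w , y) ∷ L) (at ∷ ats) =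
    trans (cong₂ _+_ (head≡ at) (weightedSum-≡⇐ L ats)) (sym (ℚP.*-distribˡ-+ M w (totalWeight L)))
    where
    head≡ : w ≡ 0ℚ ⊎ F y ≡ M → w * F y ≡ M * w
    head≡ (inj₁ refl) = trans (ℚP.*-zeroˡ (F y)) (sym (ℚP.*-zeroʳ M))
    head≡ (inj₂ Fy≡M) = trans (cong (w *_) Fy≡M) (ℚP.*-comm w M)

module _ {d} {S : Pt d → Set} (c : Pt d) (M : ℚ) (bounded : ∀ y → S y → c · y ℚ.≤ M) where

  Conv-bound : ∀ x → Conv S x → c · x ℚ.≤ M
  Conv-bound x (L , ok , total≡1 , x≗) = begin
    c · x                   ≡⟨ trans (·-congʳ c x≗) (·-combination c L) ⟩
    weightedSum L (c ·_)    ≤⟨ weightedSum-≤ (c ·_) M L (All.map (λ { (0≤w , Sy) → 0≤w , bounded _ Sy }) ok) ⟩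
    M * totalWeight L       ≡⟨ trans (cong (M *_) total≡1) (ℚP.*-identityʳ M) ⟩
    M                       ∎
    where open ℚP.≤-Reasoning

  Conv-transfer : ∀ (c′ : Pt d) M′ → (∀ y → S y → c · y ≡ M → c′ · y ≡ M′) →
                  ∀ x → Conv S x → c · x ≡ M → c′ · x ≡ M′
  Conv-transfer c′ M′ transfer x (L , ok , total≡1 , x≗) c·x≡M = begin
    c′ · x                   ≡⟨ trans (·-congʳ c′ x≗) (·-combination c′ L) ⟩
    weightedSum L (c′ ·_)    ≡⟨ weightedSum-≡⇐ (c′ ·_) M′ L (All.zipWith moved (ok , attained)) ⟩
    M′ * totalWeight L       ≡⟨ trans (cong (M′ *_) total≡1) (ℚP.*-identityʳ M′) ⟩
    M′                       ∎
    where
    open ≡-Reasoning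
    attained : All (WeightlessOrAt (c ·_) M) L
    attained = weightedSum-≡⇒ (c ·_) M L (All.map (λ { (0≤w , Sy) → 0≤w , bounded _ Sy }) ok)
      (trans (sym (trans (·-congʳ c x≗) (·-combination c L)))
             (trans c·x≡M (sym (trans (cong (M *_) total≡1) (ℚP.*-identityʳ M)))))
    moved : ∀ {p} → (0ℚ ℚ.≤ proj₁ p × S (proj₂ p)) × WeightlessOrAt (c ·_) M p → WeightlessOrAt (c′ ·_) M′ p
    moved ((_ , Sy) , inj₁ w≡0) = inj₁ w≡0
    moved ((_ , Sy) , inj₂ at)  = inj₂ (transfer _ Sy at)

·-permute : ∀ {d} (c x : Pt d) π → c · (x ∘ (π ⟨$⟩ʳ_)) ≡ (c ∘ (π ⟨$⟩ˡ_)) · x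
·-permute c x π = trans (·-permuted≡sorted c x π) (sym (·-as-sum (sorted c π) x))

Gen⇒permuted-vertex : ∀ {m y} → Gen (suc m) y →
                      ∃ λ (i : Fin m) → ∀ c π → (c ∘ (π ⟨$⟩ˡ_)) · y ≡ c · vertex i π
Gen⇒permuted-vertex {m} {y} (i , 1+i<d , y≗) = i′ , λ c π →
  trans (sym (·-permute c y π)) (·-congʳ c (y≗generator ∘ (π ⟨$⟩ʳ_)))
  where
  i′ = fromℕ< (ℕP.≤-pred 1+i<d)
  y≗generator : ∀ k → y k ≡ generator i′ k
  y≗generator k = trans (y≗ k) (cong (λ j → γ₀ (suc m) k + a (suc m) j k) (sym (FinP.toℕ-fromℕ< (ℕP.≤-pred 1+i<d))))

PermutedP : ∀ d → Pt d → Set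
PermutedP d y = Σ (Pt d) λ x → P d x × Σ (Permutation′ d) λ π → ∀ k → y k ≡ x (π ⟨$⟩ʳ k)

_⊑_ : ∀ {n} → Pt (suc (suc n)) → Pt (suc (suc n)) → Set
c ⊑ c′ = ∀ i π → c · vertex i π ≡ optimum c → c′ · vertex i π ≡ optimum c′

module _ {n} (c : Pt (suc (suc n))) where

  Gen-bound : ∀ π y → Gen _ y → (c ∘ (π ⟨$⟩ˡ_)) · y ℚ.≤ optimum c
  Gen-bound π y y-gen = let (i , value) = Gen⇒permuted-vertex y-gen in
    ℚP.≤-trans (ℚP.≤-reflexive (value c π)) (vertex≤optimum c i π)

  P-bound : ∀ π x → P _ x → c · (x ∘ (π ⟨$⟩ʳ_)) ℚ.≤ optimum c
  P-bound π x x∈P = ℚP.≤-trans (ℚP.≤-reflexive (·-permute c x π))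
                               (Conv-bound (c ∘ (π ⟨$⟩ˡ_)) (optimum c) (Gen-bound π) x x∈P)

  PermutedP-bound : ∀ y → PermutedP _ y → c · y ℚ.≤ optimum c
  PermutedP-bound y (x , x∈P , π , y≗) = ℚP.≤-trans (ℚP.≤-reflexive (·-congʳ c y≗)) (P-bound π x x∈P)

  SdP-bound : ∀ x → SdP _ x → c · x ℚ.≤ optimum c
  SdP-bound = Conv-bound c (optimum c) PermutedP-bound

module _ {n} (c c′ : Pt (suc (suc n))) (c⊑c′ : c ⊑ c′) where

  P-transfer : ∀ π x → P _ x → c · (x ∘ (π ⟨$⟩ʳ_)) ≡ optimum c → c′ · (x ∘ (π ⟨$⟩ʳ_)) ≡ optimum c′
  P-transfer π x x∈P optimal = trans (·-permute c′ x π)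
    (Conv-transfer (c ∘ (π ⟨$⟩ˡ_)) (optimum c) (Gen-bound c π) (c′ ∘ (π ⟨$⟩ˡ_)) (optimum c′) transfer x x∈P
      (trans (sym (·-permute c x π)) optimal))
    where
    transfer : ∀ y → Gen _ y → (c ∘ (π ⟨$⟩ˡ_)) · y ≡ optimum c → (c′ ∘ (π ⟨$⟩ˡ_)) · y ≡ optimum c′
    transfer y y-gen eq = let (i , value) = Gen⇒permuted-vertex y-gen in
      trans (value c′ π) (c⊑c′ i π (trans (sym (value c π)) eq))

  SdP-transfer : ∀ x → SdP _ x → c · x ≡ optimum c → c′ · x ≡ optimum c′
  SdP-transfer = Conv-transfer c (optimum c) (PermutedP-bound c) c′ (optimum c′)
    λ { y (x , x∈P , π , y≗) eq → trans (·-congʳ c′ y≗) (P-transfer π x x∈P (trans (sym (·-congʳ c y≗)) eq)) }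

Conv-⊇ : ∀ {d} {S : Pt d → Set} {y} → S y → Conv S y
Conv-⊇ Sy = ((1ℚ , _) ∷ []) , ((ℚP.<⇒≤ (ℚP.positive⁻¹ 1ℚ) , Sy) ∷ []) , ℚP.+-identityʳ 1ℚ ,
            λ k → sym (trans (ℚP.+-identityʳ _) (ℚP.*-identityˡ _))

vertex∈SdP : ∀ {n} (i : Fin (suc n)) π → SdP (suc (suc n)) (vertex i π)
vertex∈SdP i π = Conv-⊇ (generator i , Conv-⊇ (toℕ i , s≤s (FinP.toℕ<n i) , λ k → refl) , π , λ k → refl)

face : ∀ {n} → Pt (suc (suc n)) → Face (SdP (suc (suc n)))
face c = record
  { c        = c
  ; M        = optimum c
  ; support  = SdP-bound c
  ; nonempty = vertex (maxGapIndex c) (sortPerm c) , vertex∈SdP (maxGapIndex c) (sortPerm c) , optimal-vertex c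
  }

Face-M≡optimum : ∀ {n} (F : Face (SdP (suc (suc n)))) → Face.M F ≡ optimum (Face.c F)
Face-M≡optimum F = ℚP.≤-antisym M≤optimum optimum≤M
  where
  open Face F
  M≤optimum : M ℚ.≤ optimum c
  M≤optimum = let (x , x∈SdP , c·x≡M) = nonempty in
    ℚP.≤-trans (ℚP.≤-reflexive (sym c·x≡M)) (SdP-bound c x x∈SdP)
  optimum≤M : optimum c ℚ.≤ M
  optimum≤M = ℚP.≤-trans (ℚP.≤-reflexive (sym (optimal-vertex c))) (support _ (vertex∈SdP (maxGapIndex c) (sortPerm c)))

⊆F⇒⊑ : ∀ {n} (F G : Face (SdP (suc (suc n)))) → F ⊆F G → Face.c F ⊑ Face.c G
⊆F⇒⊑ F G F⊆G i π optimal = trans (proj₂ (F⊆G _ (vertex∈SdP i π , trans optimal (sym (Face-M≡optimum F)))))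
                                 (Face-M≡optimum G)

⊑⇒⊆F : ∀ {n} (F G : Face (SdP (suc (suc n)))) → Face.c F ⊑ Face.c G → F ⊆F G
⊑⇒⊆F F G c⊑c′ x (x∈SdP , on-F) =
  x∈SdP , trans (SdP-transfer (Face.c F) (Face.c G) c⊑c′ x x∈SdP (trans on-F (Face-M≡optimum F))) (sym (Face-M≡optimum G))

stepwise-mono : ∀ (f : ℕ → ℕ) → (∀ r → f r ℕ.≤ f (suc r)) → f Preserves ℕ._≤_ ⟶ ℕ._≤_
stepwise-mono f step {p} {zero}  z≤n = ℕP.≤-refl
stepwise-mono f step {p} {suc q} p≤1+q with ℕP.m≤n⇒m<n∨m≡n p≤1+q
... | inj₁ p<1+q = ℕP.≤-trans (stepwise-mono f step (ℕP.≤-pred p<1+q)) (step q)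
... | inj₂ refl  = ℕP.≤-refl

Ascent : (ℕ → ℚ) → ℕ → Set
Ascent u r = u r ℚ.< u (suc r)

ascents : (ℕ → ℚ) → ℕ → ℕ
ascents u zero    = zero
ascents u (suc p) = ascents u p ℕ.+ 𝟙 (u p ℚP.<? u (suc p))

module _ (u : ℕ → ℚ) where

  ascents-ascent : ∀ p → Ascent u p → ascents u (suc p) ≡ suc (ascents u p)
  ascents-ascent p ascent with u p ℚP.<? u (suc p)
  ... | yes _ = ℕP.+-comm (ascents u p) 1
  ... | no ¬ascent = ⊥-elim (¬ascent ascent)

  ascents-flat : ∀ p → ¬ Ascent u p → ascents u (suc p) ≡ ascents u p
  ascents-flat p ¬ascent with u p ℚP.<? u (suc p)
  ... | yes ascent = ⊥-elim (¬ascent ascent)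
  ... | no _ = ℕP.+-identityʳ (ascents u p)

  ascents-suc≤ : ∀ p → ascents u (suc p) ℕ.≤ suc (ascents u p)
  ascents-suc≤ p with u p ℚP.<? u (suc p)
  ... | yes _ = ℕP.≤-reflexive (ℕP.+-comm (ascents u p) 1)
  ... | no _  = ℕP.≤-trans (ℕP.≤-reflexive (ℕP.+-identityʳ (ascents u p))) (ℕP.n≤1+n _)

  ascents-mono : ascents u Preserves ℕ._≤_ ⟶ ℕ._≤_
  ascents-mono = stepwise-mono (ascents u) (λ r → ℕP.m≤m+n (ascents u r) _)

  ascents-< : ∀ {q r p} → q ℕ.≤ r → r ℕ.< p → Ascent u r → ascents u q ℕ.< ascents u p
  ascents-< {q} {r} {p} q≤r r<p ascent = begin-strict
    ascents u q        ≤⟨ ascents-mono q≤r ⟩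
    ascents u r        <⟨ ℕP.≤-reflexive (sym (ascents-ascent r ascent)) ⟩
    ascents u (suc r)  ≤⟨ ascents-mono r<p ⟩
    ascents u p        ∎
    where open ℕP.≤-Reasoning

  ascents-const : ∀ {q p} → q ℕ.≤ p → (∀ r → q ℕ.≤ r → r ℕ.< p → ¬ Ascent u r) → ascents u q ≡ ascents u p
  ascents-const {q} {zero}  z≤n   _    = refl
  ascents-const {q} {suc p} q≤1+p flat with ℕP.m≤n⇒m<n∨m≡n q≤1+p
  ... | inj₂ refl  = refl
  ... | inj₁ q<1+p = trans (ascents-const (ℕP.≤-pred q<1+p) (λ r q≤r r<p → flat r q≤r (ℕP.m≤n⇒m≤1+n r<p)))
                           (sym (ascents-flat p (flat p (ℕP.≤-pred q<1+p) ℕP.≤-refl)))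

  ascents-intermediate : ∀ j p → j ℕ.≤ ascents u p → ∃ λ q → q ℕ.≤ p × ascents u q ≡ j
  ascents-intermediate j zero    z≤n = zero , z≤n , refl
  ascents-intermediate j (suc p) j≤ with j ℕP.≤? ascents u p
  ... | yes j≤′ = let (q , q≤p , eq) = ascents-intermediate j p j≤′ in q , ℕP.m≤n⇒m≤1+n q≤p , eq
  ... | no j≰   = suc p , ℕP.≤-refl , ℕP.≤-antisym (ℕP.≤-trans (ascents-suc≤ p) (ℕP.≰⇒> j≰)) j≤

  ascents-pos⇒ascent : ∀ p → 0 ℕ.< ascents u p → ∃ λ r → r ℕ.< p × Ascent u r
  ascents-pos⇒ascent (suc p) 0< with u p ℚP.<? u (suc p)
  ... | yes ascent = p , ℕP.≤-refl , ascent
  ... | no _ = let (r , r<p , ascent) = ascents-pos⇒ascent p (subst (0 ℕ.<_) (ℕP.+-identityʳ (ascents u p)) 0<)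
               in r , ℕP.m≤n⇒m≤1+n r<p , ascent

  module _ (u-mono : u Preserves ℕ._≤_ ⟶ ℚ._≤_) where

    ascent-between : ∀ q p → q ℕ.≤ p → u q ℚ.< u p → ∃ λ r → q ℕ.≤ r × r ℕ.< p × Ascent u r
    ascent-between q zero    z≤n uq<up = ⊥-elim (ℚP.<-irrefl refl uq<up)
    ascent-between q (suc p) q≤1+p uq<up with ℕP.m≤n⇒m<n∨m≡n q≤1+p
    ... | inj₂ refl  = ⊥-elim (ℚP.<-irrefl refl uq<up)
    ... | inj₁ q<1+p with u p ℚP.<? u (suc p)
    ...   | yes ascent = p , ℕP.≤-pred q<1+p , ℕP.≤-refl , ascent
    ...   | no ¬ascent =
      let (r , q≤r , r<p , ascent) = ascent-between q p (ℕP.≤-pred q<1+p) (ℚP.<-≤-trans uq<up (ℚP.≮⇒≥ ¬ascent))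
      in r , q≤r , ℕP.m≤n⇒m≤1+n r<p , ascent

    ≤⇒ascents≤ : ∀ p q → u p ℚ.≤ u q → ascents u p ℕ.≤ ascents u q
    ≤⇒ascents≤ p q up≤uq with p ℕP.≤? q
    ... | yes p≤q = ascents-mono p≤q
    ... | no p≰q  = ℕP.≤-reflexive (sym (ascents-const q≤p flat))
      where
      q≤p = ℕP.<⇒≤ (ℕP.≰⇒> p≰q)
      flat : ∀ r → q ℕ.≤ r → r ℕ.< p → ¬ Ascent u r
      flat r q≤r r<p ascent = <⇒≱ (ℚP.≤-<-trans (u-mono q≤r) (ℚP.<-≤-trans ascent (u-mono r<p))) up≤uq

    ascents≤⇒≤ : ∀ p q → ascents u p ℕ.≤ ascents u q → u p ℚ.≤ u q
    ascents≤⇒≤ p q ascents≤ with p ℕP.≤? q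
    ... | yes p≤q = u-mono p≤q
    ... | no p≰q  = ℚP.≮⇒≥ λ uq<up →
      let (r , q≤r , r<p , ascent) = ascent-between q p (ℕP.<⇒≤ (ℕP.≰⇒> p≰q)) uq<up
      in ℕP.<⇒≱ (ascents-< q≤r r<p ascent) ascents≤

ascents-cong : ∀ (u v : ℕ → ℚ) → (∀ r → Ascent u r → Ascent v r) → (∀ r → Ascent v r → Ascent u r) →
               ∀ p → ascents u p ≡ ascents v p
ascents-cong u v u⇒v v⇒u zero    = refl
ascents-cong u v u⇒v v⇒u (suc p) with u p ℚP.<? u (suc p) | v p ℚP.<? v (suc p)
... | yes _ | yes _ = cong (ℕ._+ 1) (ascents-cong u v u⇒v v⇒u p)
... | no _  | no _  = cong (ℕ._+ 0) (ascents-cong u v u⇒v v⇒u p)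
... | yes a | no ¬b = ⊥-elim (¬b (u⇒v p a))
... | no ¬a | yes b = ⊥-elim (¬a (v⇒u p b))

clamp : ∀ {m} → ℕ → Fin (suc m)
clamp {m}     zero    = zero
clamp {zero}  (suc r) = zero
clamp {suc m} (suc r) = suc (clamp r)

toℕ-clamp : ∀ {m} r → r ℕ.≤ m → toℕ (clamp {m} r) ≡ r
toℕ-clamp {m}     zero    _         = refl
toℕ-clamp {suc m} (suc r) (s≤s r≤m) = cong suc (toℕ-clamp r r≤m)

clamp-toℕ : ∀ {m} (p : Fin (suc m)) → clamp (toℕ p) ≡ p
clamp-toℕ {m}     zero    = refl
clamp-toℕ {suc m} (suc p) = cong suc (clamp-toℕ p)

clamp-mono : ∀ {m} {r r′} → r ℕ.≤ r′ → toℕ (clamp {m} r) ℕ.≤ toℕ (clamp {m} r′)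
clamp-mono {m}     {zero}            _         = z≤n
clamp-mono {zero}  {suc r} {suc r′}  _         = z≤n
clamp-mono {suc m} {suc r} {suc r′}  (s≤s r≤r′) = s≤s (clamp-mono r≤r′)

clamp-in-range : ∀ {m r} → suc r ℕ.< suc m → toℕ (clamp {m} r) ≡ r × toℕ (clamp {m} (suc r)) ≡ suc r
clamp-in-range {m} {r} 1+r<d = toℕ-clamp r (ℕP.<⇒≤ (ℕP.≤-pred 1+r<d)) , toℕ-clamp (suc r) (ℕP.≤-pred 1+r<d)

BlockLe : ∀ {d} → OSP d → Fin d → Fin d → Set
BlockLe S x y = toℕ (OSP.blk S x) ℕ.≤ toℕ (OSP.blk S y)

blockIndex : ∀ {d} → OSP d → Pt d
blockIndex S x = ℕ→ℚ (toℕ (OSP.blk S x))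

≤O-fromBlockLe : ∀ {d} (S S′ : OSP d) → (∀ x y → BlockLe S x y → BlockLe S′ x y) → S ≤O S′
≤O-fromBlockLe {d} S S′ S⇒S′ = merge , merge-mono , merge-surj , blk′≡merge∘blk
  where
  open OSP
  rep : Fin (k S) → Fin d
  rep j = proj₁ (surj S j)
  blk-rep : ∀ j → blk S (rep j) ≡ j
  blk-rep j = proj₂ (surj S j)
  merge : Fin (k S) → Fin (k S′)
  merge j = blk S′ (rep j)
  merge-mono : ∀ i j → toℕ i ℕ.≤ toℕ j → toℕ (merge i) ℕ.≤ toℕ (merge j)
  merge-mono i j i≤j = S⇒S′ (rep i) (rep j) (subst₂ (λ a b → toℕ a ℕ.≤ toℕ b) (sym (blk-rep i)) (sym (blk-rep j)) i≤j)
  same-block : ∀ x y → blk S x ≡ blk S y → blk S′ x ≡ blk S′ y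
  same-block x y eq = FinP.toℕ-injective (ℕP.≤-antisym (S⇒S′ x y (ℕP.≤-reflexive (cong toℕ eq)))
                                                       (S⇒S′ y x (ℕP.≤-reflexive (cong toℕ (sym eq)))))
  blk′≡merge∘blk : ∀ x → blk S′ x ≡ merge (blk S x)
  blk′≡merge∘blk x = same-block x (rep (blk S x)) (sym (blk-rep (blk S x)))
  merge-surj : ∀ j′ → Σ (Fin (k S)) λ j → merge j ≡ j′
  merge-surj j′ = let (x , blk′x≡j′) = surj S′ j′ in blk S x , trans (sym (blk′≡merge∘blk x)) blk′x≡j′

≤O⇒blk< : ∀ {d} (S S′ : OSP d) → S ≤O S′ → ∀ x y →
          toℕ (OSP.blk S′ x) ℕ.< toℕ (OSP.blk S′ y) → toℕ (OSP.blk S x) ℕ.< toℕ (OSP.blk S y)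
≤O⇒blk< S S′ (merge , merge-mono , _ , blk′≡merge∘blk) x y blk′x<blk′y = ℕP.≰⇒> λ blk-y≤blk-x →
  ℕP.<⇒≱ blk′x<blk′y (subst₂ (λ a b → toℕ a ℕ.≤ toℕ b) (sym (blk′≡merge∘blk y)) (sym (blk′≡merge∘blk x))
                         (merge-mono _ _ blk-y≤blk-x))

length-filter-tabulate : ∀ {m} {A : Set} {P : Pred A 0ℓ} (P? : Decidable P) (f : Fin m → A) →
                         length (filter P? (tabulate f)) ≡ count (P? ∘ f)
length-filter-tabulate {zero}  P? f = refl
length-filter-tabulate {suc m} P? f with P? (f zero)
... | yes _ = cong suc (length-filter-tabulate P? (f ∘ suc))
... | no _  = length-filter-tabulate P? (f ∘ suc)

sum-filter-tabulate : ∀ {m} {A : Set} {P : Pred A 0ℓ} (P? : Decidable P) (g : A → ℕ) (f : Fin m → A) →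
                      List.sum (map g (filter P? (tabulate f))) ≡ ℕΣ.sum (λ x → 𝟙 (P? (f x)) ℕ.* g (f x))
sum-filter-tabulate {zero}  P? g f = refl
sum-filter-tabulate {suc m} P? g f with P? (f zero)
... | yes _ = cong₂ ℕ._+_ (sym (ℕP.+-identityʳ (g (f zero)))) (sum-filter-tabulate P? g (f ∘ suc))
... | no _  = sum-filter-tabulate P? g (f ∘ suc)

partialSum≡count : ∀ {d} (S : OSP d) (i : Fin (OSP.k S)) →
                   partialSum S i ≡ count (λ x → toℕ (OSP.blk S x) ℕP.≤? toℕ i)
partialSum≡count {d} S i = begin
  partialSum S i
    ≡⟨ sum-filter-tabulate (λ j → toℕ j ℕP.≤? toℕ i) (blockSize S) (λ j → j) ⟩
  ℕΣ.sum (λ j → 𝟙 (toℕ j ℕP.≤? toℕ i) ℕ.* blockSize S j)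
    ≡⟨ ℕΣ.sum-cong-≗ (λ j → cong (𝟙 (toℕ j ℕP.≤? toℕ i) ℕ.*_)
                                  (length-filter-tabulate (λ x → blk x FinP.≟ j) (λ x → x))) ⟩
  ℕΣ.sum (λ j → 𝟙 (toℕ j ℕP.≤? toℕ i) ℕ.* count (λ x → blk x FinP.≟ j))
    ≡⟨ ℕΣ.sum-cong-≗ (λ j → ℕΣ.*-distribˡ-sum (𝟙 (toℕ j ℕP.≤? toℕ i)) (λ x → 𝟙 (blk x FinP.≟ j))) ⟩
  ℕΣ.sum (λ j → ℕΣ.sum (λ x → indicator j x))
    ≡⟨ ℕΣ.∑-comm indicator ⟩
  ℕΣ.sum (λ x → ℕΣ.sum (λ j → indicator j x))
    ≡⟨ ℕΣ.sum-cong-≗ (λ x → SumSupport.sum-supported-at ℕP.+-0-commutativeMonoid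
                                (λ j → indicator j x) (blk x) (off-block x)) ⟩
  ℕΣ.sum (λ x → indicator (blk x) x)
    ≡⟨ ℕΣ.sum-cong-≗ (λ x → on-block x) ⟩
  count (λ x → toℕ (blk x) ℕP.≤? toℕ i) ∎
  where
  open ≡-Reasoning
  open OSP S
  indicator : Fin k → Fin d → ℕ
  indicator j x = 𝟙 (toℕ j ℕP.≤? toℕ i) ℕ.* 𝟙 (blk x FinP.≟ j)
  off-block : ∀ x j → j ≢ blk x → indicator j x ≡ 0
  off-block x j j≢blk with blk x FinP.≟ j
  ... | yes blk≡j = ⊥-elim (j≢blk (sym blk≡j))
  ... | no _      = ℕP.*-zeroʳ (𝟙 (toℕ j ℕP.≤? toℕ i))
  on-block : ∀ x → indicator (blk x) x ≡ 𝟙 (toℕ (blk x) ℕP.≤? toℕ i)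
  on-block x with blk x FinP.≟ blk x
  ... | yes _  = ℕP.*-identityʳ (𝟙 (toℕ (blk x) ℕP.≤? toℕ i))
  ... | no ≢   = ⊥-elim (≢ refl)

module BlockSequence {m} (S : OSP (suc m)) (π : Permutation′ (suc m)) (π-sorts : Sorts (blockIndex S) π) where
  open OSP S

  blockAt : Fin (suc m) → ℕ
  blockAt p = toℕ (blk (π ⟨$⟩ˡ p))

  blockAt-mono : ∀ {p q} → toℕ p ℕ.≤ toℕ q → blockAt p ℕ.≤ blockAt q
  blockAt-mono p≤q = ℕ→ℚ-cancel-≤ (sorted-mono (blockIndex S) π π-sorts p≤q)

  blockAt-π : ∀ x → blockAt (π ⟨$⟩ʳ x) ≡ toℕ (blk x)
  blockAt-π x = cong (toℕ ∘ blk) (inverseˡ π)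

  blockSeq : ℕ → ℚ
  blockSeq r = ℕ→ℚ (blockAt (clamp r))

  blockSeq-mono : blockSeq Preserves ℕ._≤_ ⟶ ℚ._≤_
  blockSeq-mono r≤r′ = ℕ→ℚ-mono-≤ (blockAt-mono (clamp-mono r≤r′))

  count-blockAt≤ : ∀ i → count (λ p → blockAt p ℕP.≤? toℕ i) ≡ partialSum S i
  count-blockAt≤ i = begin
    count (λ p → blockAt p ℕP.≤? toℕ i)
      ≡⟨ count-permute (λ p → blockAt p ℕP.≤? toℕ i) π ⟨
    count (λ x → blockAt (π ⟨$⟩ʳ x) ℕP.≤? toℕ i)
      ≡⟨ count-cong (λ x → blockAt (π ⟨$⟩ʳ x) ℕP.≤? toℕ i) (λ x → toℕ (blk x) ℕP.≤? toℕ i)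
                    (λ x → subst (ℕ._≤ toℕ i) (blockAt-π x)) (λ x → subst (ℕ._≤ toℕ i) (sym (blockAt-π x))) ⟩
    count (λ x → toℕ (blk x) ℕP.≤? toℕ i)
      ≡⟨ partialSum≡count S i ⟨
    partialSum S i
      ∎
    where open ≡-Reasoning

  <partialSum⇒blockAt≤ : ∀ i p → toℕ p ℕ.< partialSum S i → blockAt p ℕ.≤ toℕ i
  <partialSum⇒blockAt≤ i p p< = <count⇒initial (λ p → blockAt p ℕP.≤? toℕ i)
    (λ p≤q → ℕP.≤-trans (blockAt-mono p≤q)) p (subst (toℕ p ℕ.<_) (sym (count-blockAt≤ i)) p<)

  blockAt≤⇒<partialSum : ∀ i p → blockAt p ℕ.≤ toℕ i → toℕ p ℕ.< partialSum S i
  blockAt≤⇒<partialSum i p ≤i = subst (toℕ p ℕ.<_) (count-blockAt≤ i)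
    (initial⇒<count (λ p → blockAt p ℕP.≤? toℕ i) (λ p≤q → ℕP.≤-trans (blockAt-mono p≤q)) p ≤i)

  0<partialSum : ∀ i → 0 ℕ.< partialSum S i
  0<partialSum i = let (x , blk-x≡i) = surj i in
    ℕP.≤-<-trans z≤n (blockAt≤⇒<partialSum i (π ⟨$⟩ʳ x) (ℕP.≤-reflexive (trans (blockAt-π x) (cong toℕ blk-x≡i))))

  -- Opaque because unfolding these proofs makes every use normalise rational arithmetic.
  opaque
    InType⇒ascent : ∀ n → InType S n → ∃ λ r → n ≡ suc r × suc r ℕ.< suc m × Ascent blockSeq r
    InType⇒ascent n (i , 1+i<k , n≡) with partialSum S i in N≡ | 0<partialSum i
    ... | suc r | _ = r , n≡ , 1+r<d , ℕ→ℚ-mono-< (ℕP.≤-<-trans before after)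
      where
      next : Fin (suc m)
      next = proj₁ (surj (fromℕ< 1+i<k))
      next-block : blockAt (π ⟨$⟩ʳ next) ≡ suc (toℕ i)
      next-block = trans (blockAt-π next) (trans (cong toℕ (proj₂ (surj (fromℕ< 1+i<k)))) (FinP.toℕ-fromℕ< 1+i<k))
      1+r≤next : suc r ℕ.≤ toℕ (π ⟨$⟩ʳ next)
      1+r≤next = ℕP.≮⇒≥ λ next< → ℕP.1+n≰n (subst (ℕ._≤ toℕ i) next-block
                   (<partialSum⇒blockAt≤ i _ (subst (toℕ (π ⟨$⟩ʳ next) ℕ.<_) (sym N≡) next<)))
      1+r<d : suc r ℕ.< suc m
      1+r<d = ℕP.≤-<-trans 1+r≤next (FinP.toℕ<n _)
      before : blockAt (clamp r) ℕ.≤ toℕ i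
      before = <partialSum⇒blockAt≤ i (clamp r)
                 (subst₂ ℕ._<_ (sym (proj₁ (clamp-in-range 1+r<d))) (sym N≡) (ℕP.n<1+n r))
      after : toℕ i ℕ.< blockAt (clamp (suc r))
      after = ℕP.≰⇒> λ ≤i → ℕP.<-irrefl refl
                (subst₂ ℕ._<_ (proj₂ (clamp-in-range 1+r<d)) N≡ (blockAt≤⇒<partialSum i (clamp (suc r)) ≤i))

    ascent⇒InType : ∀ r → suc r ℕ.< suc m → Ascent blockSeq r → InType S (suc r)
    ascent⇒InType r 1+r<d ascent = i , 1+i<k , sym (ℕP.≤-antisym N≤1+r r<N)
      where
      blockAt< : blockAt (clamp r) ℕ.< blockAt (clamp (suc r))
      blockAt< = ℕ→ℚ-cancel-< ascent
      i : Fin k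
      i = blk (π ⟨$⟩ˡ clamp r)
      r<N : r ℕ.< partialSum S i
      r<N = subst (ℕ._< partialSum S i) (proj₁ (clamp-in-range 1+r<d)) (blockAt≤⇒<partialSum i (clamp r) ℕP.≤-refl)
      N≤1+r : partialSum S i ℕ.≤ suc r
      N≤1+r = ℕP.≮⇒≥ λ 1+r<N → ℕP.<⇒≱ blockAt<
        (<partialSum⇒blockAt≤ i (clamp (suc r)) (subst (ℕ._< partialSum S i) (sym (proj₂ (clamp-in-range 1+r<d))) 1+r<N))
      1+i<k : suc (toℕ i) ℕ.< k
      1+i<k = ℕP.<-≤-trans (s≤s blockAt<) (FinP.toℕ<n (blk (π ⟨$⟩ˡ clamp (suc r))))

Decorates : ∀ {d} → OSP d → List ℕ → Set
Decorates {d} S B =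
  ((1 ℕ.< OSP.k S) × (∀ n → n ∈ B → InType S n) × (Σ ℕ λ n → n ∈ B))
  ⊎
  ((OSP.k S ≡ 1) × (∀ n → (n ∈ B → (1 ℕ.≤ n × n ℕ.≤ d ℕ.∸ 1))
                        × ((1 ℕ.≤ n × n ℕ.≤ d ℕ.∸ 1) → n ∈ B)))

-- From faces to decorated ordered set partitions

module Levels {m} (c : Pt (suc m)) where

  private
    σ = sortPerm c

  valueSeq : ℕ → ℚ
  valueSeq r = sorted c σ (clamp r)

  valueSeq-mono : valueSeq Preserves ℕ._≤_ ⟶ ℚ._≤_
  valueSeq-mono r≤r′ = sorted-mono c σ (sortPerm-sorts c) (clamp-mono r≤r′)

  valueSeq-position : ∀ x → valueSeq (toℕ (σ ⟨$⟩ʳ x)) ≡ c x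
  valueSeq-position x = trans (cong (λ p → c (σ ⟨$⟩ˡ p)) (clamp-toℕ _)) (cong c (inverseˡ σ))

  level : Fin (suc m) → ℕ
  level x = ascents valueSeq (toℕ (σ ⟨$⟩ʳ x))

  level<k : ∀ x → level x ℕ.< suc (ascents valueSeq m)
  level<k x = s≤s (ascents-mono valueSeq (ℕP.≤-pred (FinP.toℕ<n (σ ⟨$⟩ʳ x))))

  levelOSP : OSP (suc m)
  levelOSP = record { k = suc (ascents valueSeq m) ; blk = λ x → fromℕ< (level<k x) ; surj = surj }
    where
    surj : ∀ j → Σ (Fin (suc m)) λ x → fromℕ< (level<k x) ≡ j
    surj j = σ ⟨$⟩ˡ clamp q , FinP.toℕ-injective (begin
      toℕ (fromℕ< (level<k (σ ⟨$⟩ˡ clamp q)))           ≡⟨ FinP.toℕ-fromℕ< _ ⟩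
      ascents valueSeq (toℕ (σ ⟨$⟩ʳ (σ ⟨$⟩ˡ clamp q)))  ≡⟨ cong (ascents valueSeq ∘ toℕ) (inverseʳ σ) ⟩
      ascents valueSeq (toℕ (clamp {m} q))             ≡⟨ cong (ascents valueSeq) (toℕ-clamp q q≤m) ⟩
      ascents valueSeq q                               ≡⟨ level≡j ⟩
      toℕ j                                            ∎)
      where
      open ≡-Reasoning
      intermediate = ascents-intermediate valueSeq (toℕ j) m (ℕP.≤-pred (FinP.toℕ<n j))
      q = proj₁ intermediate
      q≤m = proj₁ (proj₂ intermediate)
      level≡j = proj₂ (proj₂ intermediate)

  toℕ-blk : ∀ x → toℕ (OSP.blk levelOSP x) ≡ level x
  toℕ-blk x = FinP.toℕ-fromℕ< (level<k x)

  ≤⇒BlockLe : ∀ x y → c x ℚ.≤ c y → BlockLe levelOSP x y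
  ≤⇒BlockLe x y cx≤cy = subst₂ ℕ._≤_ (sym (toℕ-blk x)) (sym (toℕ-blk y))
    (≤⇒ascents≤ valueSeq valueSeq-mono _ _ (subst₂ ℚ._≤_ (sym (valueSeq-position x)) (sym (valueSeq-position y)) cx≤cy))

  BlockLe⇒≤ : ∀ x y → BlockLe levelOSP x y → c x ℚ.≤ c y
  BlockLe⇒≤ x y x≤y = subst₂ ℚ._≤_ (valueSeq-position x) (valueSeq-position y)
    (ascents≤⇒≤ valueSeq valueSeq-mono _ _ (subst₂ ℕ._≤_ (toℕ-blk x) (toℕ-blk y) x≤y))

  blk<⇒< : ∀ x y → toℕ (OSP.blk levelOSP x) ℕ.< toℕ (OSP.blk levelOSP y) → c x ℚ.< c y
  blk<⇒< x y blk< = ℚP.≰⇒> λ cy≤cx → ℕP.<⇒≱ blk< (≤⇒BlockLe y x cy≤cx)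

  <⇒blk< : ∀ x y → c x ℚ.< c y → toℕ (OSP.blk levelOSP x) ℕ.< toℕ (OSP.blk levelOSP y)
  <⇒blk< x y cx<cy = ℕP.≰⇒> λ blk≤ → <⇒≱ cx<cy (BlockLe⇒≤ y x blk≤)

  sortPerm-sorts-blocks : Sorts (blockIndex levelOSP) σ
  sortPerm-sorts-blocks x y blk< = sortPerm-sorts c x y (blk<⇒< x y (ℕ→ℚ-cancel-< blk<))

  open BlockSequence levelOSP σ sortPerm-sorts-blocks using (blockSeq; ascent⇒InType)

  blockSeq≡ascents : ∀ r → r ℕ.≤ m → blockSeq r ≡ ℕ→ℚ (ascents valueSeq r)
  blockSeq≡ascents r r≤m = cong ℕ→ℚ (begin
    toℕ (OSP.blk levelOSP (σ ⟨$⟩ˡ clamp r))           ≡⟨ toℕ-blk (σ ⟨$⟩ˡ clamp r) ⟩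
    ascents valueSeq (toℕ (σ ⟨$⟩ʳ (σ ⟨$⟩ˡ clamp r)))  ≡⟨ cong (ascents valueSeq ∘ toℕ) (inverseʳ σ) ⟩
    ascents valueSeq (toℕ (clamp {m} r))             ≡⟨ cong (ascents valueSeq) (toℕ-clamp r r≤m) ⟩
    ascents valueSeq r                               ∎)
    where open ≡-Reasoning

  valueAscent⇒InType : ∀ r → suc r ℕ.< suc m → Ascent valueSeq r → InType levelOSP (suc r)
  valueAscent⇒InType r 1+r<d ascent = ascent⇒InType r 1+r<d
    (subst₂ ℚ._<_ (sym (blockSeq≡ascents r (ℕP.<⇒≤ (ℕP.≤-pred 1+r<d))))
                  (sym (blockSeq≡ascents (suc r) (ℕP.≤-pred 1+r<d)))
      (ℕ→ℚ-mono-< (ℕP.≤-reflexive (sym (ascents-ascent valueSeq r ascent)))))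

open Levels using (valueSeq; valueSeq-mono; levelOSP)

module _ {n} (c : Pt (suc (suc n))) where

  gaps≡valueSeq : ∀ i → gaps c i ≡ valueSeq c (suc (toℕ i)) - valueSeq c (toℕ i)
  gaps≡valueSeq i = cong₂ (λ p q → sorted c (sortPerm c) p - sorted c (sortPerm c) q)
    (sym (clamp-toℕ (suc i)))
    (sym (trans (cong clamp (sym (FinP.toℕ-inject₁ i))) (clamp-toℕ (inject₁ i))))

  0<gap⇒ascent : ∀ i → 0ℚ ℚ.< gaps c i → Ascent (valueSeq c) (toℕ i)
  0<gap⇒ascent i 0<gap = ℚP.≰⇒> λ next≤ → <⇒≱ 0<gap (ℚP.≤-trans (ℚP.≤-reflexive (gaps≡valueSeq i))
    (ℚP.≤-trans (ℚP.+-monoˡ-≤ _ next≤) (ℚP.≤-reflexive (ℚP.+-inverseʳ (valueSeq c (toℕ i))))))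

  ascent⇒0<gap : ∀ i → Ascent (valueSeq c) (toℕ i) → 0ℚ ℚ.< gaps c i
  ascent⇒0<gap i ascent = subst (0ℚ ℚ.<_) (sym (gaps≡valueSeq i)) (p<q⇒0<q-p ascent)

  maxGapSet : List ℕ
  maxGapSet = map (suc ∘ toℕ) (filter (maxGap? c) (allFin (suc n)))

  ∈maxGapSet⁺ : ∀ i → MaxGap c i → suc (toℕ i) ∈ maxGapSet
  ∈maxGapSet⁺ i max = Membership.∈-map⁺ (suc ∘ toℕ) (Membership.∈-filter⁺ (maxGap? c) (Membership.∈-allFin i) max)

  ∈maxGapSet⁻ : ∀ {b} → b ∈ maxGapSet → ∃ λ i → b ≡ suc (toℕ i) × MaxGap c i
  ∈maxGapSet⁻ b∈ = let (i , i∈ , b≡) = Membership.∈-map⁻ (suc ∘ toℕ) b∈ in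
    i , b≡ , proj₂ (Membership.∈-filter⁻ (maxGap? c) i∈)

  single-level⇒maxGap : ascents (valueSeq c) (suc n) ≡ 0 → ∀ i → MaxGap c i
  single-level⇒maxGap single i = trans (gap≡0 i) (sym (gap≡0 (maxGapIndex c)))
    where
    gap≡0 : ∀ i → gaps c i ≡ 0ℚ
    gap≡0 i = ℚP.≤-antisym (ℚP.≮⇒≥ λ 0<gap → ℕP.<⇒≢ (ascents-< (valueSeq c) z≤n (FinP.toℕ<n i) (0<gap⇒ascent i 0<gap))
                                                   (sym single))
                           (ℚP.≤-trans (ℚP.≤-reflexive (sym (ℚP.+-inverseʳ (valueSeq c (toℕ i)))))
                             (ℚP.≤-trans (ℚP.+-monoˡ-≤ _ (valueSeq-mono c (ℕP.n≤1+n _)))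
                                         (ℚP.≤-reflexive (sym (gaps≡valueSeq i)))))

  several-levels⇒InType : 0 ℕ.< ascents (valueSeq c) (suc n) → ∀ i → MaxGap c i → InType (levelOSP c) (suc (toℕ i))
  several-levels⇒InType several i max = Levels.valueAscent⇒InType c (toℕ i) (s≤s (FinP.toℕ<n i))
    (0<gap⇒ascent i (ℚP.<-≤-trans 0<gap₀ (ℚP.≤-trans (gap≤maxGap c i₀) (ℚP.≤-reflexive (sym max)))))
    where
    witness = ascents-pos⇒ascent (valueSeq c) (suc n) several
    i₀ = fromℕ< (proj₁ (proj₂ witness))
    0<gap₀ : 0ℚ ℚ.< gaps c i₀
    0<gap₀ = ascent⇒0<gap i₀ (subst (Ascent (valueSeq c)) (sym (FinP.toℕ-fromℕ< _)) (proj₂ (proj₂ witness)))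

  faceDOSP : DOSP (suc (suc n))
  faceDOSP = record { S = levelOSP c ; B = maxGapSet ; ok = ok (ascents (valueSeq c) (suc n)) refl }
    where
    ok : ∀ ℓ → ascents (valueSeq c) (suc n) ≡ ℓ → Decorates (levelOSP c) maxGapSet
    ok zero single = inj₂ (cong suc single , λ b → in-range b , from-range b)
      where
      in-range : ∀ b → b ∈ maxGapSet → 1 ℕ.≤ b × b ℕ.≤ suc n
      in-range b b∈ = let (i , b≡ , _) = ∈maxGapSet⁻ b∈ in
        subst (λ b → 1 ℕ.≤ b × b ℕ.≤ suc n) (sym b≡) (s≤s z≤n , FinP.toℕ<n i)
      from-range : ∀ b → 1 ℕ.≤ b × b ℕ.≤ suc n → b ∈ maxGapSet
      from-range (suc r) (_ , r<) = subst (_∈ maxGapSet) (cong suc (FinP.toℕ-fromℕ< r<))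
                                      (∈maxGapSet⁺ (fromℕ< r<) (single-level⇒maxGap single _))
    ok (suc ℓ) several = inj₁ (subst (1 ℕ.<_) (cong suc (sym several)) (s≤s (s≤s z≤n)) , ⊆Type ,
                              suc (toℕ (maxGapIndex c)) , ∈maxGapSet⁺ (maxGapIndex c) refl)
      where
      ⊆Type : ∀ b → b ∈ maxGapSet → InType (levelOSP c) b
      ⊆Type b b∈ = let (i , b≡ , max) = ∈maxGapSet⁻ b∈ in
        subst (InType (levelOSP c)) (sym b≡) (several-levels⇒InType (subst (0 ℕ.<_) (sym several) (s≤s z≤n)) i max)

module _ {n} {c c′ : Pt (suc (suc n))} where

  ⊑⇒≤-preserved : c ⊑ c′ → ∀ x y → c x ℚ.≤ c y → c′ x ℚ.≤ c′ y
  ⊑⇒≤-preserved c⊑c′ x y cx≤cy = ℚP.≮⇒≥ λ c′y<c′x →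
    let x≢y = λ x≡y → ℚP.<-irrefl (cong c′ (sym x≡y)) c′y<c′x
        (ρ , ρ-sorts , ρx<ρy) = sorting-separates c x y cx≤cy x≢y
        ρ-optimal-c′ = c⊑c′ (maxGapIndex c) ρ (sorts×maxGap⇒optimal c (maxGapIndex c) ρ ρ-sorts refl)
    in ℕP.<-asym ρx<ρy (proj₁ (optimal⇒sorts×maxGap c′ (maxGapIndex c) ρ ρ-optimal-c′) y x c′y<c′x)

  ⊑⇒faceDOSP≼ : c ⊑ c′ → faceDOSP c ≼ faceDOSP c′
  ⊑⇒faceDOSP≼ c⊑c′ = ≤O-fromBlockLe (levelOSP c) (levelOSP c′) blocks , maxGaps
    where
    blocks : ∀ x y → BlockLe (levelOSP c) x y → BlockLe (levelOSP c′) x y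
    blocks x y x≤y = Levels.≤⇒BlockLe c′ x y (⊑⇒≤-preserved c⊑c′ x y (Levels.BlockLe⇒≤ c x y x≤y))
    maxGaps : ∀ b → b ∈ maxGapSet c → b ∈ maxGapSet c′
    maxGaps b b∈ = let (i , b≡ , max) = ∈maxGapSet⁻ c b∈ in subst (_∈ maxGapSet c′) (sym b≡)
      (∈maxGapSet⁺ c′ i (proj₂ (optimal⇒sorts×maxGap c′ i (sortPerm c)
        (c⊑c′ i (sortPerm c) (sorts×maxGap⇒optimal c i (sortPerm c) (sortPerm-sorts c) max)))))

  faceDOSP≼⇒⊑ : faceDOSP c ≼ faceDOSP c′ → c ⊑ c′
  faceDOSP≼⇒⊑ (S≤S′ , B⊆B′) i π optimal = sorts×maxGap⇒optimal c′ i π π-sorts-c′ max′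
    where
    π-sorts-c = proj₁ (optimal⇒sorts×maxGap c i π optimal)
    π-sorts-c′ : Sorts c′ π
    π-sorts-c′ x y c′x<c′y = π-sorts-c x y (Levels.blk<⇒< c x y
      (≤O⇒blk< (levelOSP c) (levelOSP c′) S≤S′ x y (Levels.<⇒blk< c′ x y c′x<c′y)))
    max′ : MaxGap c′ i
    max′ = let max = proj₂ (optimal⇒sorts×maxGap c i π optimal)
               (i′ , 1+i≡ , max′) = ∈maxGapSet⁻ c′ (B⊆B′ _ (∈maxGapSet⁺ c i max))
           in subst (MaxGap c′) (sym (FinP.toℕ-injective (ℕP.suc-injective 1+i≡))) max′

-- From decorated ordered set partitions to functionals

weightOf : ∀ {A B : Set} → Dec A → Dec B → ℕ
weightOf (yes _) (yes _) = 2
weightOf (yes _) (no _)  = 1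
weightOf (no _)  _       = 0

module _ {A B : Set} where

  weightOf≤2 : ∀ (a? : Dec A) (b? : Dec B) → weightOf a? b? ℕ.≤ 2
  weightOf≤2 (yes _) (yes _) = ℕP.≤-refl
  weightOf≤2 (yes _) (no _)  = s≤s z≤n
  weightOf≤2 (no _)  _       = z≤n

  weightOf-pos⇒ : ∀ (a? : Dec A) (b? : Dec B) → 0 ℕ.< weightOf a? b? → A
  weightOf-pos⇒ (yes a) _ _ = a

  weightOf-pos⇐ : ∀ (a? : Dec A) (b? : Dec B) → A → 0 ℕ.< weightOf a? b?
  weightOf-pos⇐ (yes _) (yes _) _ = s≤s z≤n
  weightOf-pos⇐ (yes _) (no _)  _ = s≤s z≤n
  weightOf-pos⇐ (no ¬a) _       a = ⊥-elim (¬a a)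

  weightOf≡0 : ∀ (a? : Dec A) (b? : Dec B) → ¬ A → weightOf a? b? ≡ 0
  weightOf≡0 (yes a) _ ¬a = ⊥-elim (¬a a)
  weightOf≡0 (no _)  _ _  = refl

  weightOf≡2⇒ : ∀ (a? : Dec A) (b? : Dec B) → weightOf a? b? ≡ 2 → B
  weightOf≡2⇒ (yes _) (yes b) _ = b

  weightOf≡2⇐ : ∀ (a? : Dec A) (b? : Dec B) → A → B → weightOf a? b? ≡ 2
  weightOf≡2⇐ (yes _) (yes _) _ _ = refl
  weightOf≡2⇐ (yes _) (no ¬b) _ b = ⊥-elim (¬b b)
  weightOf≡2⇐ (no ¬a) _       a _ = ⊥-elim (¬a a)

module FromDOSP {n} (D : DOSP (suc (suc n))) where
  open DOSP D using (S; B)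
  open OSP S using (k; blk)

  private
    σ = sortPerm (blockIndex S)

  open BlockSequence S σ (sortPerm-sorts (blockIndex S)) using (blockSeq; blockSeq-mono; InType⇒ascent; ascent⇒InType)

  opaque
    weight : ℕ → ℕ
    weight r = weightOf (blockSeq r ℚP.<? blockSeq (suc r)) (suc r ∈? B)

    weight≤2 : ∀ r → weight r ℕ.≤ 2
    weight≤2 r = weightOf≤2 (blockSeq r ℚP.<? blockSeq (suc r)) (suc r ∈? B)

    0<weight⇒ascent : ∀ r → 0 ℕ.< weight r → Ascent blockSeq r
    0<weight⇒ascent r = weightOf-pos⇒ (blockSeq r ℚP.<? blockSeq (suc r)) (suc r ∈? B)

    ascent⇒0<weight : ∀ r → Ascent blockSeq r → 0 ℕ.< weight r
    ascent⇒0<weight r = weightOf-pos⇐ (blockSeq r ℚP.<? blockSeq (suc r)) (suc r ∈? B)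

    ¬ascent⇒weight≡0 : ∀ r → ¬ Ascent blockSeq r → weight r ≡ 0
    ¬ascent⇒weight≡0 r = weightOf≡0 (blockSeq r ℚP.<? blockSeq (suc r)) (suc r ∈? B)

    weight≡2⇒decorated : ∀ r → weight r ≡ 2 → suc r ∈ B
    weight≡2⇒decorated r = weightOf≡2⇒ (blockSeq r ℚP.<? blockSeq (suc r)) (suc r ∈? B)

    decorated-ascent⇒weight≡2 : ∀ r → Ascent blockSeq r → suc r ∈ B → weight r ≡ 2
    decorated-ascent⇒weight≡2 r = weightOf≡2⇐ (blockSeq r ℚP.<? blockSeq (suc r)) (suc r ∈? B)

  height : ℕ → ℕ
  height zero    = zero
  height (suc r) = height r ℕ.+ weight r

  heightSeq : ℕ → ℚ
  heightSeq = ℕ→ℚ ∘ height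

  height-mono : height Preserves ℕ._≤_ ⟶ ℕ._≤_
  height-mono = stepwise-mono height (λ r → ℕP.m≤m+n (height r) (weight r))

  heightSeq-mono : heightSeq Preserves ℕ._≤_ ⟶ ℚ._≤_
  heightSeq-mono = ℕ→ℚ-mono-≤ ∘ height-mono

  heightAscent⇒blockAscent : ∀ r → Ascent heightSeq r → Ascent blockSeq r
  heightAscent⇒blockAscent r ascent = 0<weight⇒ascent r
    (ℕP.+-cancelˡ-< (height r) 0 (weight r) (subst (ℕ._< height r ℕ.+ weight r) (sym (ℕP.+-identityʳ (height r)))
                                                   (ℕ→ℚ-cancel-< ascent)))

  blockAscent⇒heightAscent : ∀ r → Ascent blockSeq r → Ascent heightSeq r
  blockAscent⇒heightAscent r ascent = ℕ→ℚ-mono-< (ℕP.m<m+n (height r) (ascent⇒0<weight r ascent))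

  position : Fin (suc (suc n)) → ℕ
  position x = toℕ (σ ⟨$⟩ʳ x)

  weightVector : Pt (suc (suc n))
  weightVector x = heightSeq (position x)

  σ-sorts-weightVector : Sorts weightVector σ
  σ-sorts-weightVector x y wx<wy = ℕP.≰⇒> λ σy≤σx → <⇒≱ wx<wy (heightSeq-mono σy≤σx)

  sorted-weightVector : ∀ p → sorted weightVector σ p ≡ heightSeq (toℕ p)
  sorted-weightVector p = cong (heightSeq ∘ toℕ) (inverseʳ σ)

  blockSeq-position : ∀ x → blockSeq (position x) ≡ blockIndex S x
  blockSeq-position x = cong (ℕ→ℚ ∘ toℕ ∘ blk) (trans (cong (σ ⟨$⟩ˡ_) (clamp-toℕ _)) (inverseˡ σ))

  ascents-heightSeq : ∀ p → ascents heightSeq p ≡ ascents blockSeq p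
  ascents-heightSeq = ascents-cong heightSeq blockSeq heightAscent⇒blockAscent blockAscent⇒heightAscent

  BlockLe⇒≤ : ∀ x y → BlockLe S x y → weightVector x ℚ.≤ weightVector y
  BlockLe⇒≤ x y x≤y = ascents≤⇒≤ heightSeq heightSeq-mono (position x) (position y)
    (subst₂ ℕ._≤_ (sym (ascents-heightSeq (position x))) (sym (ascents-heightSeq (position y)))
      (≤⇒ascents≤ blockSeq blockSeq-mono (position x) (position y)
        (subst₂ ℚ._≤_ (sym (blockSeq-position x)) (sym (blockSeq-position y)) (ℕ→ℚ-mono-≤ x≤y))))

  ≤⇒BlockLe : ∀ x y → weightVector x ℚ.≤ weightVector y → BlockLe S x y
  ≤⇒BlockLe x y wx≤wy = ℕ→ℚ-cancel-≤ (subst₂ ℚ._≤_ (blockSeq-position x) (blockSeq-position y)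
    (ascents≤⇒≤ blockSeq blockSeq-mono (position x) (position y)
      (subst₂ ℕ._≤_ (ascents-heightSeq (position x)) (ascents-heightSeq (position y))
        (≤⇒ascents≤ heightSeq heightSeq-mono (position x) (position y) wx≤wy))))

  gaps-weightVector : ∀ i → gaps weightVector i ≡ ℕ→ℚ (weight (toℕ i))
  gaps-weightVector i = begin
    gaps weightVector i
      ≡⟨ cong₂ _-_ (same-sorted (suc i)) (same-sorted (inject₁ i)) ⟩
    sorted weightVector σ (suc i) - sorted weightVector σ (inject₁ i)
      ≡⟨ cong₂ _-_ (sorted-weightVector (suc i))
                   (trans (sorted-weightVector (inject₁ i)) (cong heightSeq (FinP.toℕ-inject₁ i))) ⟩
    ℕ→ℚ (height (toℕ i) ℕ.+ weight (toℕ i)) - ℕ→ℚ (height (toℕ i))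
      ≡⟨ cong (_- ℕ→ℚ (height (toℕ i))) (ℕ→ℚ-+ (height (toℕ i)) (weight (toℕ i))) ⟩
    (ℕ→ℚ (height (toℕ i)) + ℕ→ℚ (weight (toℕ i))) - ℕ→ℚ (height (toℕ i))
      ≡⟨ solve 2 (λ h w → (h :+ w) :- h := w) refl (ℕ→ℚ (height (toℕ i))) (ℕ→ℚ (weight (toℕ i))) ⟩
    ℕ→ℚ (weight (toℕ i))
      ∎
    where
    open ≡-Reasoning
    open ℚ-Solver
    same-sorted : ∀ p → sorted weightVector (sortPerm weightVector) p ≡ sorted weightVector σ p
    same-sorted = sorted-unique weightVector (sortPerm weightVector) σ (sortPerm-sorts weightVector) σ-sorts-weightVector

  MaxGap⇒decorated : (∀ b → b ∈ B → InType S b) → (Σ ℕ λ b → b ∈ B) →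
                     ∀ i → MaxGap weightVector i → suc (toℕ i) ∈ B
  MaxGap⇒decorated B⊆Type (b₀ , b₀∈B) i max = weight≡2⇒decorated (toℕ i)
    (ℕP.≤-antisym (weight≤2 (toℕ i)) (ℕ→ℚ-cancel-≤ (begin
      ℕ→ℚ 2                          ≡⟨ cong ℕ→ℚ weight₀≡2 ⟨
      ℕ→ℚ (weight (toℕ i₀))          ≡⟨ gaps-weightVector i₀ ⟨
      gaps weightVector i₀           ≤⟨ gap≤maxGap weightVector i₀ ⟩
      maxGap weightVector            ≡⟨ max ⟨
      gaps weightVector i            ≡⟨ gaps-weightVector i ⟩
      ℕ→ℚ (weight (toℕ i))           ∎)))
    where
    open ℚP.≤-Reasoning
    decorated-ascent = InType⇒ascent b₀ (B⊆Type b₀ b₀∈B)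
    r₀ = proj₁ decorated-ascent
    r₀<1+n : r₀ ℕ.< suc n
    r₀<1+n = ℕP.≤-pred (proj₁ (proj₂ (proj₂ decorated-ascent)))
    i₀ = fromℕ< r₀<1+n
    weight₀≡2 : weight (toℕ i₀) ≡ 2
    weight₀≡2 = trans (cong weight (FinP.toℕ-fromℕ< r₀<1+n))
      (decorated-ascent⇒weight≡2 r₀ (proj₂ (proj₂ (proj₂ decorated-ascent)))
        (subst (_∈ B) (proj₁ (proj₂ decorated-ascent)) b₀∈B))

  decorated⇒MaxGap : (∀ b → b ∈ B → InType S b) → ∀ i → suc (toℕ i) ∈ B → MaxGap weightVector i
  decorated⇒MaxGap B⊆Type i 1+i∈B = ℚP.≤-antisym (gap≤maxGap weightVector i) (begin
    maxGap weightVector                              ≡⟨ gaps-weightVector (maxGapIndex weightVector) ⟩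
    ℕ→ℚ (weight (toℕ (maxGapIndex weightVector)))   ≤⟨ ℕ→ℚ-mono-≤ (weight≤2 (toℕ (maxGapIndex weightVector))) ⟩
    ℕ→ℚ 2                                           ≡⟨ cong ℕ→ℚ weight≡2 ⟨
    ℕ→ℚ (weight (toℕ i))                            ≡⟨ gaps-weightVector i ⟨
    gaps weightVector i                             ∎)
    where
    open ℚP.≤-Reasoning
    decorated-ascent = InType⇒ascent (suc (toℕ i)) (B⊆Type (suc (toℕ i)) 1+i∈B)
    r≡i : proj₁ decorated-ascent ≡ toℕ i
    r≡i = ℕP.suc-injective (sym (proj₁ (proj₂ decorated-ascent)))
    weight≡2 : weight (toℕ i) ≡ 2
    weight≡2 = decorated-ascent⇒weight≡2 (toℕ i)
                 (subst (Ascent blockSeq) r≡i (proj₂ (proj₂ (proj₂ decorated-ascent)))) 1+i∈B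

  single-block⇒MaxGap : k ≡ 1 → ∀ i → MaxGap weightVector i
  single-block⇒MaxGap k≡1 i = trans (gap≡0 i) (sym (gap≡0 (maxGapIndex weightVector)))
    where
    blockSeq≡0 : ∀ r → blockSeq r ≡ ℕ→ℚ 0
    blockSeq≡0 r = let b = blk (σ ⟨$⟩ˡ clamp r) in cong ℕ→ℚ (ℕP.n<1⇒n≡0 (subst (toℕ b ℕ.<_) k≡1 (FinP.toℕ<n b)))
    gap≡0 : ∀ i → gaps weightVector i ≡ 0ℚ
    gap≡0 i = trans (gaps-weightVector i) (cong ℕ→ℚ (¬ascent⇒weight≡0 (toℕ i)
      λ ascent → ℚP.<-irrefl (trans (blockSeq≡0 (toℕ i)) (sym (blockSeq≡0 (suc (toℕ i))))) ascent))

  decorated⇔MaxGap : ∀ i → (suc (toℕ i) ∈ B → MaxGap weightVector i) × (MaxGap weightVector i → suc (toℕ i) ∈ B)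
  decorated⇔MaxGap i = by-shape (DOSP.ok D)
    where
    by-shape : Decorates S B → (suc (toℕ i) ∈ B → MaxGap weightVector i) × (MaxGap weightVector i → suc (toℕ i) ∈ B)
    by-shape (inj₁ (_ , B⊆Type , nonempty)) = decorated⇒MaxGap B⊆Type i , MaxGap⇒decorated B⊆Type nonempty i
    by-shape (inj₂ (k≡1 , range))           = (λ _ → single-block⇒MaxGap k≡1 i) ,
                                               (λ _ → proj₂ (range (suc (toℕ i))) (s≤s z≤n , FinP.toℕ<n i))

  decorated⇒index : ∀ b → b ∈ B → ∃ λ (i : Fin (suc n)) → b ≡ suc (toℕ i)
  decorated⇒index b b∈B = in-range b (by-shape (DOSP.ok D))
    where
    in-range : ∀ b → 1 ℕ.≤ b × b ℕ.≤ suc n → ∃ λ (i : Fin (suc n)) → b ≡ suc (toℕ i)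
    in-range (suc r) (_ , r<1+n) = fromℕ< r<1+n , cong suc (sym (FinP.toℕ-fromℕ< r<1+n))
    by-shape : Decorates S B → 1 ℕ.≤ b × b ℕ.≤ suc n
    by-shape (inj₁ (_ , B⊆Type , _)) = let (r , b≡ , 1+r<d , _) = InType⇒ascent b (B⊆Type b b∈B) in
      subst (λ b → 1 ℕ.≤ b × b ℕ.≤ suc n) (sym b≡) (s≤s z≤n , ℕP.≤-pred 1+r<d)
    by-shape (inj₂ (_ , range)) = proj₁ (range b) b∈B

  faceDOSP-weightVector≼ : faceDOSP weightVector ≼ D
  faceDOSP-weightVector≼ =
    ≤O-fromBlockLe (levelOSP weightVector) S (λ x y x≤y → ≤⇒BlockLe x y (Levels.BlockLe⇒≤ weightVector x y x≤y)) ,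
    λ b b∈ → let (i , b≡ , max) = ∈maxGapSet⁻ weightVector b∈ in subst (_∈ B) (sym b≡) (proj₂ (decorated⇔MaxGap i) max)

  ≼faceDOSP-weightVector : D ≼ faceDOSP weightVector
  ≼faceDOSP-weightVector =
    ≤O-fromBlockLe S (levelOSP weightVector) (λ x y x≤y → Levels.≤⇒BlockLe weightVector x y (BlockLe⇒≤ x y x≤y)) ,
    λ b b∈B → let (i , b≡) = decorated⇒index b b∈B in
      subst (_∈ maxGapSet weightVector) (sym b≡)
            (∈maxGapSet⁺ weightVector i (proj₁ (decorated⇔MaxGap i) (subst (_∈ B) b≡ b∈B)))

mainTheorem18 : (d : ℕ) → 2 ≤ d → OrderIso (_⊆F_ {d} {SdP d}) (_≼_ {d})
mainTheorem18 (suc (suc n)) (s≤s (s≤s z≤n)) = record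
  { to      = toDOSP
  ; from    = fromDOSP
  ; to-mono = λ F G F⊆G → ⊑⇒faceDOSP≼ (⊆F⇒⊑ F G F⊆G)
  ; to-refl = to-refl
  ; to-from = λ D → faceDOSP-weightVector≼ D , ≼faceDOSP-weightVector D
  ; from-to = λ F → to-refl (fromDOSP (toDOSP F)) F (faceDOSP-weightVector≼ (toDOSP F)) ,
                    to-refl F (fromDOSP (toDOSP F)) (≼faceDOSP-weightVector (toDOSP F))
  }
  where
  open FromDOSP using (weightVector; faceDOSP-weightVector≼; ≼faceDOSP-weightVector)
  toDOSP : Face (SdP (suc (suc n))) → DOSP (suc (suc n))
  toDOSP F = faceDOSP (Face.c F)
  fromDOSP : DOSP (suc (suc n)) → Face (SdP (suc (suc n)))
  fromDOSP D = face (weightVector D)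
  to-refl : ∀ F G → toDOSP F ≼ toDOSP G → F ⊆F G
  to-refl F G F≼G = ⊑⇒⊆F F G (faceDOSP≼⇒⊑ F≼G)
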